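{- Let $p,q\ge1$ be integers. There is a bijection from $\mathrm{PPF}^{\mathrm{inc}}(K_{p*,q})$ to $\mathrm{PF}^{\mathrm{inc}}(K_{(p-1)*,q})$. In particular, $|\mathrm{PPF}^{\mathrm{inc}}(K_{p*,q})|=|\mathrm{PF}^{\mathrm{inc}}(K_{(p-1)*,q})|=\frac{1}{p+q-1}\binom{p+q-1}{p}\binom{p+q-1}{p-1}$.
   Context: For integers $a\ge0$, $q\ge1$, $K_{a*,q}$ is the complete bipartite graph with parts $P=\{v^p_0,v^p_1,\dots,v^p_a\}$ and $Q=\{v^q_1,\dots,v^q_q\}$ (a single edge between each pair in $P\times Q$, no other edges), with sink $v^p_0$. $\mathbb N=\{1,2,\dots\}$. For a graph $H$ (finite multigraph, no loops) with sink $s$, vertex set $V_H$, non-sink vertex set $\tilde V_H$, write $\deg^A(v)=\sum_{w\in A}\mathrm{mult}(vw)$, $\mathrm{mult}(vw)$ the number of edges between $v,w$. An $H$-parking function is $f:\tilde V_H\to\mathbb N$ such that every non-empty $S\subseteq\tilde V_H$ contains $v$ with $f(v)\le\deg^{V_H\setminus S}(v)$; $\mathrm{PF}(H)$ is their set. For a graph $G$ with sink $s$ and $A\subseteq\tilde V$, $G^A$ is the induced subgraph on $A\cup\{s\}$ with sink $s$. For $f\in\mathrm{PF}(G)$ and an ordered partition $(A,B)$ of $\tilde V$ with $A,B\neq\emptyset$, set $f^A=f|_A$, $f^B(v)=f(v)-\deg^A(v)$ ($v\in B$); $f$ is decomposable w.r.t. $(A,B)$ if $f^A\in\mathrm{PF}(G^A)$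 and $f^B\in\mathrm{PF}(G^B)$; $f$ is prime if decomposable w.r.t. no such partition; $\mathrm{PPF}(G)$ is the set of prime $G$-parking functions. A function $f$ on the non-sink vertices of $K_{a*,q}$ is increasing if $f(v^p_1)\le\dots\le f(v^p_a)$ and $f(v^q_1)\le\dots\le f(v^q_q)$. $\mathrm{PF}^{\mathrm{inc}}$ and $\mathrm{PPF}^{\mathrm{inc}}$ denote the sets of increasing parking functions and increasing prime parking functions. -}

module Defs where

open import Data.Nat using (ℕ; zero; suc; _+_; _*_; _∸_; _≤_; _<_; _≤ᵇ_)
open import Data.Bool using (Bool; true; false; if_then_else_; _xor_; _∧_; not)
open import Data.Fin using (Fin; toℕ) renaming (zero to fz; suc to fs)
open import Data.Fin.Subset using (Subset; _∈_; _⊆_; Nonempty; ∁; ⊤)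
open import Data.Vec using (lookup)
open import Data.List using (List; map; allFin)
open import Data.Nat.ListAction using (sum)
open import Data.Product using (Σ; ∃; _×_; _,_; proj₁)
open import Relation.Nullary using (¬_)
open import Relation.Binary.Bundles using (Setoid)
open import Relation.Binary.PropositionalEquality using (_≡_; refl; sym; trans)
import Relation.Binary.PropositionalEquality as ≡

-- A finite multigraph with sink.  Vertex set Fin (suc n); the sink is vertex fz,
-- the non-sink vertices are  fs i  for  i : Fin n.  mult v w = number of edges v–w.
record Graph : Set where
  field
    n       : ℕ
    mult    : Fin (suc n) → Fin (suc n) → ℕ
    symm    : ∀ v w → mult v w ≡ mult w v
    noLoops : ∀ v → mult v v ≡ 0
open Graph public

Σfin : (m : ℕ) → (Fin m → ℕ) → ℕ
Σfin m g = sum (map g (allFin m))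

degIn : (G : Graph) → Subset (n G) → Fin (n G) → ℕ
degIn G A v = Σfin (n G) (λ w → if lookup A w then mult G (fs v) (fs w) else 0)

-- deg^{V_{G^A} \ S}(v) in the induced subgraph G^A (vertex set A ∪ {s}), for S ⊆ A:
-- edges to the sink plus edges to vertices of A not in S.
degOut : (G : Graph) → Subset (n G) → Subset (n G) → Fin (n G) → ℕ
degOut G A S v = mult G (fs v) fz + degIn G (Data.Vec.zipWith _∧_ A (∁ S)) v
  where import Data.Vec

-- f is a G^A-parking function (only the values of f on A matter).
-- Values are in ℕ = {1,2,...}, hence the positivity condition.
IsPFOn : (G : Graph) → Subset (n G) → (Fin (n G) → ℕ) → Set
IsPFOn G A f =
  (∀ v → v ∈ A → 1 ≤ f v) ×
  (∀ (S : Subset (n G)) → S ⊆ A → Nonempty S → ∃ λ v → v ∈ S × f v ≤ degOut G A S v)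

IsPF : (G : Graph) → (Fin (n G) → ℕ) → Set
IsPF G f = IsPFOn G ⊤ f

-- decomposability w.r.t. the ordered partition (A , ∁ A);
-- f^B(v) = f(v) - deg^A(v)  (truncated subtraction: a value ≤ 0 is 0, which fails
-- positivity exactly as a non-positive integer would).
Decomposable : (G : Graph) → (Fin (n G) → ℕ) → Subset (n G) → Set
Decomposable G f A = IsPFOn G A f × IsPFOn G (∁ A) (λ v → f v ∸ degIn G A v)

IsPPF : (G : Graph) → (Fin (n G) → ℕ) → Set
IsPPF G f = IsPF G f ×
  (∀ (A : Subset (n G)) → Nonempty A → Nonempty (∁ A) → ¬ Decomposable G f A)

-- K_{a*,q}.  Vertex index k : Fin (suc (a + q)):
--   k = 0 is v^p_0 (sink), k = i (1 ≤ i ≤ a) is v^p_i, k = a + j (1 ≤ j ≤ q) is v^q_j.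
isP : (a : ℕ) → {m : ℕ} → Fin m → Bool
isP a k = toℕ k ≤ᵇ a

Kmult : (a q : ℕ) → Fin (suc (a + q)) → Fin (suc (a + q)) → ℕ
Kmult a q v w = if isP a v xor isP a w then 1 else 0

xor-comm : ∀ (b c : Bool) → (b xor c) ≡ (c xor b)
xor-comm false false = refl
xor-comm false true  = refl
xor-comm true  false = refl
xor-comm true  true  = refl

xor-self : ∀ (b : Bool) → (b xor b) ≡ false
xor-self false = refl
xor-self true  = refl

K : (a q : ℕ) → Graph
K a q = record
  { n = a + q
  ; mult = Kmult a q
  ; symm = λ v w → ≡.cong (λ b → if b then 1 else 0) (xor-comm (isP a v) (isP a w))
  ; noLoops = λ v → ≡.cong (λ b → if b then 1 else 0) (xor-self (isP a v))
  }

-- Non-sink index i : Fin (a + q) corresponds to vertex index i+1, so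
-- i < a  ↔  v^p_{i+1},   i ≥ a  ↔  v^q_{i+1-a}.
-- Increasing: f(v^p_1) ≤ … ≤ f(v^p_a) and f(v^q_1) ≤ … ≤ f(v^q_q).
Increasing : (a q : ℕ) → (Fin (a + q) → ℕ) → Set
Increasing a q f =
  (∀ (i j : Fin (a + q)) → toℕ i ≤ toℕ j → toℕ j < a → f i ≤ f j) ×
  (∀ (i j : Fin (a + q)) → a ≤ toℕ i → toℕ i ≤ toℕ j → f i ≤ f j)

FunSubsetoid : (m : ℕ) → ((Fin m → ℕ) → Set) → Setoid _ _
FunSubsetoid m P = record
  { Carrier = Σ (Fin m → ℕ) P
  ; _≈_ = λ x y → ∀ i → proj₁ x i ≡ proj₁ y i
  ; isEquivalence = record
    { refl = λ i → refl
    ; sym = λ e i → sym (e i)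
    ; trans = λ e e' i → trans (e i) (e' i)
    }
  }

PFinc : (a q : ℕ) → Setoid _ _
PFinc a q = FunSubsetoid (a + q) (λ f → IsPF (K a q) f × Increasing a q f)

PPFinc : (a q : ℕ) → Setoid _ _
PPFinc a q = FunSubsetoid (a + q) (λ f → IsPPF (K a q) f × Increasing a q f)

FinSetoid : ℕ → Setoid _ _
FinSetoid N = ≡.setoid (Fin N)

-- For increasing f on K_{a*,q}, the parking condition only has to be tested on the "up-sets"
-- {v^p_k | k > i} ∪ {v^q_k | k > j}, where it reads  f(v^p_{i+1}) ≤ j  or  f(v^q_{j+1}) ≤ i + 1.
-- The same test on the "boxes" {v^p_k | k ≤ i} ∪ {v^q_k | k ≤ j} detects decompositions, so f is
-- prime on K_{p*,q} iff f(v^p_1) = 1 and the restriction of f to the other vertices is a parking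
-- function on K_{(p-1)*,q}; deleting v^p_1 is the bijection.  Writing an increasing parking function
-- of K_{a*,q} as the pair x = f(v^p_·), y = f(v^q_·) of increasing sequences, the up-set test becomes
-- the link condition y(x_k - 1) ≤ k + 1.  Splitting linked pairs according to their last entries gives
-- a recursion for their number.  It is solved by showing that the pairs (x, y) of increasing sequences
-- (lengths a and l, bounds u and b) that are not linked are as many as the pairs of lengths a + 1 and l
-- with bounds u and b - 1; this yields the product of binomial coefficients.

module Submission where

open import Defs
open import Level using (0ℓ)
open import Data.Nat
open import Data.Nat.Properties
open import Data.Nat.Combinatorics using (_C_; nCn≡1; nCk+nC[k+1]≡[n+1]C[k+1])
open import Data.Nat.ListAction using (sum)
open import Data.Nat.Solver using (module +-*-Solver)
open import Data.Bool using (Bool; true; false; if_then_else_; _∧_; _∨_; not; _xor_)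
open import Data.Bool.Properties using (T-≡; not-injective)
open import Data.Fin using (Fin; toℕ; fromℕ<) renaming (zero to fz; suc to fs)
open import Data.Fin.Properties using (toℕ<n; toℕ-fromℕ<; toℕ-injective; +↔⊎)
open import Data.Fin.Subset using (Subset; _∈_; _⊆_; Nonempty; ∁; ⊤; _∩_)
open import Data.Fin.Subset.Properties using (∈⊤; x∈p∩q⁺; x∈p∩q⁻; x∈∁p⇒x∉p; x∉p⇒x∈∁p; _∈?_)
open import Data.Vec using ([]; _∷_; lookup; tabulate)
open import Data.Vec.Properties
  using ([]=⇒lookup; lookup⇒[]=; lookup-map; lookup-zipWith; lookup-replicate; lookup∘tabulate; tabulate∘lookup; tabulate-cong)
import Data.Vec.Functional as Vecᶠ
import Data.List as List
open import Data.List.Properties using (map-tabulate)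
open import Data.Product using (Σ; ∃; _×_; _,_; proj₁; proj₂)
open import Data.Sum using (_⊎_; inj₁; inj₂; [_,_]′) renaming (map to ⊎-map)
open import Data.Sum.Relation.Binary.Pointwise using (Pointwise; _⊎ₛ_; Pointwise-≡↔≡)
open import Data.Sum.Function.Setoid using (_⊎-inverse_)
open import Data.Empty using (⊥; ⊥-elim)
open import Relation.Nullary using (¬_; yes; no; Dec; _×-dec_)
open import Relation.Binary.Bundles using (Setoid)
open import Relation.Binary.PropositionalEquality as ≡
open import Function using (_∘_; id; case_of_)
open import Function.Bundles using (Bijection; Inverse; Equivalence)
open import Function.Definitions using (Congruent; StrictlyInverseˡ; StrictlyInverseʳ)
open import Function.Properties.Inverse using (Inverse⇒Bijection)
import Function.Consequences.Setoid as Consequences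
import Function.Construct.Composition as Compose
import Function.Construct.Symmetry as Symmetry

open +-*-Solver

module _ {S T : Setoid 0ℓ 0ℓ} where
  open Setoid S using () renaming (Carrier to A; _≈_ to _≈₁_)
  open Setoid T using () renaming (Carrier to B; _≈_ to _≈₂_)

  mkInverseₛ : (to : A → B) (from : B → A) → Congruent _≈₁_ _≈₂_ to → Congruent _≈₂_ _≈₁_ from →
               StrictlyInverseˡ _≈₂_ to from → StrictlyInverseʳ _≈₁_ to from → Inverse S T
  mkInverseₛ to from to-cong from-cong invˡ invʳ = record
    { to        = to
    ; from      = from
    ; to-cong   = to-cong
    ; from-cong = from-cong
    ; inverse   = Consequences.strictlyInverseˡ⇒inverseˡ S T to-cong invˡ
                , Consequences.strictlyInverseʳ⇒inverseʳ S T from-cong invʳ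
    }

sumFin : ∀ m → (Fin m → ℕ) → ℕ
sumFin zero    g = 0
sumFin (suc m) g = g fz + sumFin m (g ∘ fs)

Σfin≡sumFin : ∀ m g → Σfin m g ≡ sumFin m g
Σfin≡sumFin zero    g = refl
Σfin≡sumFin (suc m) g = cong (g fz +_) (begin
  sum (List.map g (List.tabulate fs))  ≡⟨ cong sum (map-tabulate fs g) ⟩
  sum (List.tabulate (g ∘ fs))         ≡⟨ cong sum (sym (map-tabulate id (g ∘ fs))) ⟩
  Σfin m (g ∘ fs)                      ≡⟨ Σfin≡sumFin m (g ∘ fs) ⟩
  sumFin m (g ∘ fs)                    ∎)
  where open ≡-Reasoning

sumFin-mono-≤ : ∀ m {g h : Fin m → ℕ} → (∀ w → g w ≤ h w) → sumFin m g ≤ sumFin m h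
sumFin-mono-≤ zero    g≤h = z≤n
sumFin-mono-≤ (suc m) g≤h = +-mono-≤ (g≤h fz) (sumFin-mono-≤ m (g≤h ∘ fs))

sumFin-+ : ∀ m (g h : Fin m → ℕ) → sumFin m (λ w → g w + h w) ≡ sumFin m g + sumFin m h
sumFin-+ zero    g h = refl
sumFin-+ (suc m) g h = trans (cong (g fz + h fz +_) (sumFin-+ m (g ∘ fs) (h ∘ fs)))
  (solve 4 (λ a b c d → a :+ b :+ (c :+ d) := a :+ c :+ (b :+ d)) refl (g fz) (h fz) (sumFin m (g ∘ fs)) (sumFin m (h ∘ fs)))

sumℕ : ℕ → (ℕ → ℕ) → ℕ
sumℕ zero    h = 0
sumℕ (suc m) h = h 0 + sumℕ m (h ∘ suc)

sumFin-toℕ : ∀ m (h : ℕ → ℕ) → sumFin m (h ∘ toℕ) ≡ sumℕ m h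
sumFin-toℕ zero    h = refl
sumFin-toℕ (suc m) h = cong (h 0 +_) (sumFin-toℕ m (h ∘ suc))

sumℕ-cong : ∀ m {g h} → (∀ k → k < m → g k ≡ h k) → sumℕ m g ≡ sumℕ m h
sumℕ-cong zero    g≗h = refl
sumℕ-cong (suc m) g≗h = cong₂ _+_ (g≗h 0 z<s) (sumℕ-cong m (λ k k< → g≗h (suc k) (s≤s k<)))

sumℕ-+ : ∀ m n h → sumℕ (m + n) h ≡ sumℕ m h + sumℕ n (λ k → h (m + k))
sumℕ-+ zero    n h = refl
sumℕ-+ (suc m) n h = trans (cong (h 0 +_) (sumℕ-+ m n (h ∘ suc))) (sym (+-assoc (h 0) _ _))

sumℕ-const : ∀ m c → sumℕ m (λ _ → c) ≡ m * c
sumℕ-const zero    c = refl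
sumℕ-const (suc m) c = cong (c +_) (sumℕ-const m c)

inRange : ℕ → ℕ → ℕ → Bool
inRange lo hi k with lo ≤? k | k <? hi
... | yes _ | yes _ = true
... | _     | _     = false

inRange-intro : ∀ {lo hi k} → lo ≤ k → k < hi → inRange lo hi k ≡ true
inRange-intro {lo} {hi} {k} lo≤k k<hi with lo ≤? k | k <? hi
... | yes _    | yes _   = refl
... | no lo≰k  | _       = ⊥-elim (lo≰k lo≤k)
... | yes _    | no k≮hi = ⊥-elim (k≮hi k<hi)

inRange-elim : ∀ {lo hi k} → inRange lo hi k ≡ true → lo ≤ k × k < hi
inRange-elim {lo} {hi} {k} eq with lo ≤? k | k <? hi
inRange-elim {lo} {hi} {k} refl | yes lo≤k | yes k<hi = lo≤k , k<hi
inRange-elim {lo} {hi} {k} ()   | no _      | _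
inRange-elim {lo} {hi} {k} ()   | yes _     | no _

inRange-false : ∀ {lo hi k} → ¬ (lo ≤ k × k < hi) → inRange lo hi k ≡ false
inRange-false {lo} {hi} {k} ∉ with inRange lo hi k in eq
... | true  = ⊥-elim (∉ (inRange-elim eq))
... | false = refl

indicator : Bool → ℕ
indicator b = if b then 1 else 0

sumℕ-inRange : ∀ lo hi N → lo ≤ hi → hi ≤ N → sumℕ N (indicator ∘ inRange lo hi) ≡ hi ∸ lo
sumℕ-inRange lo hi N lo≤hi hi≤N = begin
  sumℕ N χ
    ≡⟨ cong (λ m → sumℕ m χ) N≡ ⟩
  sumℕ (lo + (d + (N ∸ hi))) χ
    ≡⟨ sumℕ-+ lo _ χ ⟩
  sumℕ lo χ + sumℕ (d + (N ∸ hi)) (λ k → χ (lo + k))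
    ≡⟨ cong (sumℕ lo χ +_) (sumℕ-+ d (N ∸ hi) _) ⟩
  sumℕ lo χ + (sumℕ d (λ k → χ (lo + k)) + sumℕ (N ∸ hi) (λ k → χ (lo + (d + k))))
    ≡⟨ cong₂ _+_ below (cong₂ _+_ inside above) ⟩
  0 + (d + 0)
    ≡⟨ +-identityʳ d ⟩
  d ∎
  where
  open ≡-Reasoning
  χ : ℕ → ℕ
  χ = indicator ∘ inRange lo hi
  d : ℕ
  d = hi ∸ lo
  lo+d≡hi : lo + d ≡ hi
  lo+d≡hi = m+[n∸m]≡n lo≤hi
  N≡ : N ≡ lo + (d + (N ∸ hi))
  N≡ = sym (trans (sym (+-assoc lo d (N ∸ hi))) (trans (cong (_+ (N ∸ hi)) lo+d≡hi) (m+[n∸m]≡n hi≤N)))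
  below : sumℕ lo χ ≡ 0
  below = trans (sumℕ-cong lo (λ k k<lo → cong indicator (inRange-false (λ (lo≤k , _) → <-irrefl refl (≤-<-trans lo≤k k<lo)))))
                (trans (sumℕ-const lo 0) (*-zeroʳ lo))
  inside : sumℕ d (λ k → χ (lo + k)) ≡ d
  inside = trans (sumℕ-cong d (λ k k<d → cong indicator (inRange-intro (m≤m+n lo k)
                   (subst (lo + k <_) lo+d≡hi (+-monoʳ-< lo k<d)))))
                 (trans (sumℕ-const d 1) (*-identityʳ d))
  above : sumℕ (N ∸ hi) (λ k → χ (lo + (d + k))) ≡ 0
  above = trans (sumℕ-cong (N ∸ hi) (λ k _ → cong indicator (inRange-false (λ (_ , k<hi) → <-irrefl refl
                  (<-≤-trans k<hi (subst (_≤ lo + (d + k)) lo+d≡hi (+-monoʳ-≤ lo (m≤m+n d k))))))))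
                (trans (sumℕ-const (N ∸ hi) 0) (*-zeroʳ (N ∸ hi)))

lookup-∁ : ∀ {m} (S : Subset m) w → lookup (∁ S) w ≡ not (lookup S w)
lookup-∁ S w = lookup-map w not S

lookup-∩ : ∀ {m} (A B : Subset m) w → lookup (A ∩ B) w ≡ (lookup A w ∧ lookup B w)
lookup-∩ A B w = lookup-zipWith _∧_ w A B

lookup-⊤ : ∀ {m} w → lookup (⊤ {m}) w ≡ true
lookup-⊤ w = lookup-replicate w true

edgesInto : (G : Graph) → Subset (n G) → Fin (n G) → Fin (n G) → ℕ
edgesInto G T v w = if lookup T w then mult G (fs v) (fs w) else 0

degIn-lowerBound : ∀ G T v lo hi → lo ≤ hi → hi ≤ n G →
  (∀ w → lo ≤ toℕ w → toℕ w < hi → w ∈ T × mult G (fs v) (fs w) ≡ 1) → hi ∸ lo ≤ degIn G T v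
degIn-lowerBound G T v lo hi lo≤hi hi≤n adjacent = begin
  hi ∸ lo                                         ≡⟨ sym (sumℕ-inRange lo hi (n G) lo≤hi hi≤n) ⟩
  sumℕ (n G) (indicator ∘ inRange lo hi)          ≡⟨ sym (sumFin-toℕ (n G) _) ⟩
  sumFin (n G) (indicator ∘ inRange lo hi ∘ toℕ)  ≤⟨ sumFin-mono-≤ (n G) pointwise ⟩
  sumFin (n G) (edgesInto G T v)                  ≡⟨ sym (Σfin≡sumFin (n G) _) ⟩
  degIn G T v                                     ∎
  where
  open ≤-Reasoning
  pointwise : ∀ w → indicator (inRange lo hi (toℕ w)) ≤ edgesInto G T v w
  pointwise w with inRange lo hi (toℕ w) in eq
  ... | false = z≤n
  ... | true with (lo≤w , w<hi) ← inRange-elim eq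
               rewrite []=⇒lookup (proj₁ (adjacent w lo≤w w<hi)) | proj₂ (adjacent w lo≤w w<hi) = ≤-refl

degIn-upperBound : ∀ G T v lo hi → lo ≤ hi → hi ≤ n G → (∀ w → mult G (fs v) (fs w) ≤ 1) →
  (∀ w → w ∈ T → mult G (fs v) (fs w) ≡ 1 → lo ≤ toℕ w × toℕ w < hi) → degIn G T v ≤ hi ∸ lo
degIn-upperBound G T v lo hi lo≤hi hi≤n simple adjacent⇒inRange = begin
  degIn G T v                                     ≡⟨ Σfin≡sumFin (n G) _ ⟩
  sumFin (n G) (edgesInto G T v)                  ≤⟨ sumFin-mono-≤ (n G) pointwise ⟩
  sumFin (n G) (indicator ∘ inRange lo hi ∘ toℕ)  ≡⟨ sumFin-toℕ (n G) _ ⟩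
  sumℕ (n G) (indicator ∘ inRange lo hi)          ≡⟨ sumℕ-inRange lo hi (n G) lo≤hi hi≤n ⟩
  hi ∸ lo                                         ∎
  where
  open ≤-Reasoning
  pointwise : ∀ w → edgesInto G T v w ≤ indicator (inRange lo hi (toℕ w))
  pointwise w with lookup T w in w∈T | mult G (fs v) (fs w) in m≡ | simple w
  ... | false | _     | _ = z≤n
  ... | true  | zero  | _ = z≤n
  ... | true  | suc zero | _ with (lo≤w , w<hi) ← adjacent⇒inRange w (lookup⇒[]= w T w∈T) m≡
                                rewrite inRange-intro lo≤w w<hi = ≤-refl
  ... | true  | suc (suc _) | s≤s ()

degIn-∖-split : ∀ G (A S : Subset (n G)) v →
  degIn G (⊤ ∩ ∁ S) v ≤ degIn G A v + degIn G (∁ A ∩ ∁ S) v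
degIn-∖-split G A S v = begin
  degIn G (⊤ ∩ ∁ S) v
    ≡⟨ Σfin≡sumFin (n G) _ ⟩
  sumFin (n G) (edgesInto G (⊤ ∩ ∁ S) v)
    ≤⟨ sumFin-mono-≤ (n G) pointwise ⟩
  sumFin (n G) (λ w → edgesInto G A v w + edgesInto G (∁ A ∩ ∁ S) v w)
    ≡⟨ sumFin-+ (n G) _ _ ⟩
  sumFin (n G) (edgesInto G A v) + sumFin (n G) (edgesInto G (∁ A ∩ ∁ S) v)
    ≡⟨ sym (cong₂ _+_ (Σfin≡sumFin (n G) _) (Σfin≡sumFin (n G) _)) ⟩
  degIn G A v + degIn G (∁ A ∩ ∁ S) v ∎
  where
  open ≤-Reasoning
  pointwise : ∀ w → edgesInto G (⊤ ∩ ∁ S) v w ≤ edgesInto G A v w + edgesInto G (∁ A ∩ ∁ S) v w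
  pointwise w rewrite lookup-∩ ⊤ (∁ S) w | lookup-∩ (∁ A) (∁ S) w | lookup-⊤ w | lookup-∁ S w | lookup-∁ A w
    with lookup A w | lookup S w
  ... | true  | true  = z≤n
  ... | true  | false = m≤m+n _ _
  ... | false | true  = z≤n
  ... | false | false = ≤-refl

-- Only the positivity of f^B can fail in a decomposition: the parking condition of f^B on G^B is
-- inherited from that of f on G.
complement-parking : ∀ G f → IsPF G f → ∀ (A S : Subset (n G)) → Nonempty S →
  ∃ λ v → v ∈ S × (f v ∸ degIn G A v ≤ degOut G (∁ A) S v)
complement-parking G f (_ , parking) A S nonempty with parking S (λ _ → ∈⊤) nonempty
... | v , v∈S , f[v]≤ = v , v∈S , m≤n+o⇒m∸n≤o (f v) (degIn G A v) (≤-trans f[v]≤ (begin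
  mult G (fs v) fz + degIn G (⊤ ∩ ∁ S) v
    ≤⟨ +-monoʳ-≤ (mult G (fs v) fz) (degIn-∖-split G A S v) ⟩
  mult G (fs v) fz + (degIn G A v + degIn G (∁ A ∩ ∁ S) v)
    ≡⟨ solve 3 (λ s a b → s :+ (a :+ b) := a :+ (s :+ b)) refl (mult G (fs v) fz) (degIn G A v) _ ⟩
  degIn G A v + degOut G (∁ A) S v ∎))
  where open ≤-Reasoning

degIn-adjacent : ∀ G T v u → u ∈ T → mult G (fs v) (fs u) ≡ 1 → 1 ≤ degIn G T v
degIn-adjacent G T v u u∈T adj = subst (_≤ degIn G T v) (m+n∸n≡m 1 (toℕ u))
  (degIn-lowerBound G T v (toℕ u) (suc (toℕ u)) (n≤1+n _) (toℕ<n u) only-u)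
  where
  only-u : ∀ w → toℕ u ≤ toℕ w → toℕ w < suc (toℕ u) → w ∈ T × mult G (fs v) (fs w) ≡ 1
  only-u w u≤w w≤u with refl ← toℕ-injective (≤-antisym (s≤s⁻¹ w≤u) u≤w) = u∈T , adj

extendℕ : ∀ {m} → (Fin m → ℕ) → ℕ → ℕ
extendℕ {zero}  f k       = 0
extendℕ {suc m} f zero    = f fz
extendℕ {suc m} f (suc k) = extendℕ (f ∘ fs) k

extendℕ-toℕ : ∀ {m} (f : Fin m → ℕ) i → extendℕ f (toℕ i) ≡ f i
extendℕ-toℕ {suc m} f fz     = refl
extendℕ-toℕ {suc m} f (fs i) = extendℕ-toℕ (f ∘ fs) i

extendℕ-cong : ∀ {m} {f g : Fin m → ℕ} → (∀ i → f i ≡ g i) → ∀ k → extendℕ f k ≡ extendℕ g k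
extendℕ-cong {zero}  f≗g k       = refl
extendℕ-cong {suc m} f≗g zero    = f≗g fz
extendℕ-cong {suc m} f≗g (suc k) = extendℕ-cong (f≗g ∘ fs) k

-- A record rather than a Π-type, so that F can be inferred from  Represents f F.
record Represents {m} (f : Fin m → ℕ) (F : ℕ → ℕ) : Set where
  constructor represents
  field agrees : ∀ i → F (toℕ i) ≡ f i
open Represents public

extendℕ-represents : ∀ {m} (f : Fin m → ℕ) → Represents f (extendℕ f)
extendℕ-represents f = represents (extendℕ-toℕ f)

memberℕ : ∀ {m} → Subset m → ℕ → Bool
memberℕ []      k       = false
memberℕ (b ∷ S) zero    = b
memberℕ (b ∷ S) (suc k) = memberℕ S k

lookup≡memberℕ : ∀ {m} (S : Subset m) i → lookup S i ≡ memberℕ S (toℕ i)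
lookup≡memberℕ (b ∷ S) fz     = refl
lookup≡memberℕ (b ∷ S) (fs i) = lookup≡memberℕ S i

∈⇒memberℕ : ∀ {m} {S : Subset m} {i} → i ∈ S → memberℕ S (toℕ i) ≡ true
∈⇒memberℕ {S = S} {i} i∈S = trans (sym (lookup≡memberℕ S i)) ([]=⇒lookup i∈S)

memberℕ⇒∈ : ∀ {m} {S : Subset m} {i} → memberℕ S (toℕ i) ≡ true → i ∈ S
memberℕ⇒∈ {S = S} {i} eq = lookup⇒[]= i S (trans (lookup≡memberℕ S i) eq)

∉⇒memberℕ : ∀ {m} {S : Subset m} {i} → i ∈ ∁ S → memberℕ S (toℕ i) ≡ false
∉⇒memberℕ {S = S} {i} i∈∁S with memberℕ S (toℕ i) in eq
... | false = refl
... | true  = ⊥-elim (x∈∁p⇒x∉p i∈∁S (memberℕ⇒∈ eq))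

memberℕ⇒∉ : ∀ {m} {S : Subset m} {i} → memberℕ S (toℕ i) ≡ false → i ∈ ∁ S
memberℕ⇒∉ {S = S} {i} eq = x∉p⇒x∈∁p (λ i∈S → true≢false (trans (sym (∈⇒memberℕ i∈S)) eq))
  where
  true≢false : true ≡ false → ⊥
  true≢false ()

subset : ∀ {m} → (ℕ → Bool) → Subset m
subset h = tabulate (h ∘ toℕ)

∈-subset⁺ : ∀ {m} (h : ℕ → Bool) {i : Fin m} → h (toℕ i) ≡ true → i ∈ subset h
∈-subset⁺ h {i} eq = lookup⇒[]= i (subset h) (trans (lookup∘tabulate (h ∘ toℕ) i) eq)

∈-subset⁻ : ∀ {m} (h : ℕ → Bool) {i : Fin m} → i ∈ subset h → h (toℕ i) ≡ true
∈-subset⁻ h {i} i∈ = trans (sym (lookup∘tabulate (h ∘ toℕ) i)) ([]=⇒lookup i∈)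

firstTrue : (ℕ → Bool) → ℕ → ℕ
firstTrue p zero    = 0
firstTrue p (suc m) with p 0
... | true  = 0
... | false = suc (firstTrue (p ∘ suc) m)

firstTrue-≤ : ∀ p m → firstTrue p m ≤ m
firstTrue-≤ p zero    = z≤n
firstTrue-≤ p (suc m) with p 0
... | true  = z≤n
... | false = s≤s (firstTrue-≤ (p ∘ suc) m)

firstTrue-before : ∀ p m k → k < firstTrue p m → p k ≡ false
firstTrue-before p (suc m) k k< with p 0 in eq
firstTrue-before p (suc m) k       ()        | true
firstTrue-before p (suc m) zero    _         | false = eq
firstTrue-before p (suc m) (suc k) (s≤s k<) | false = firstTrue-before (p ∘ suc) m k k<

firstTrue-at : ∀ p m → firstTrue p m < m → p (firstTrue p m) ≡ true
firstTrue-at p (suc m) first< with p 0 in eq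
... | true  = eq
... | false = firstTrue-at (p ∘ suc) m (s≤s⁻¹ first<)

firstTrue-minimal : ∀ p m k → p k ≡ true → firstTrue p m ≤ k
firstTrue-minimal p m k pk with firstTrue p m ≤? k
... | yes first≤k = first≤k
... | no  first≰k with () ← trans (sym pk) (firstTrue-before p m k (≰⇒> first≰k))

inEither : ℕ → ℕ → ℕ → ℕ → ℕ → Bool
inEither lo hi lo′ hi′ k = inRange lo hi k ∨ inRange lo′ hi′ k

inEither-intro₁ : ∀ {lo hi lo′ hi′ k} → lo ≤ k → k < hi → inEither lo hi lo′ hi′ k ≡ true
inEither-intro₁ lo≤k k<hi rewrite inRange-intro lo≤k k<hi = refl

inEither-intro₂ : ∀ {lo hi lo′ hi′ k} → lo′ ≤ k → k < hi′ → inEither lo hi lo′ hi′ k ≡ true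
inEither-intro₂ {lo} {hi} {k = k} lo′≤k k<hi′ rewrite inRange-intro lo′≤k k<hi′ with inRange lo hi k
... | true  = refl
... | false = refl

inEither-elim : ∀ {lo hi lo′ hi′ k} → inEither lo hi lo′ hi′ k ≡ true → (lo ≤ k × k < hi) ⊎ (lo′ ≤ k × k < hi′)
inEither-elim {lo} {hi} {k = k} eq with inRange lo hi k in eq₁
... | true  = inj₁ (inRange-elim eq₁)
... | false = inj₂ (inRange-elim eq)

inEither-false : ∀ {lo hi lo′ hi′ k} → ¬ (lo ≤ k × k < hi) → ¬ (lo′ ≤ k × k < hi′) → inEither lo hi lo′ hi′ k ≡ false
inEither-false {lo} {hi} {lo′} {hi′} {k} ∉₁ ∉₂ with inEither lo hi lo′ hi′ k in eq
... | true  = ⊥-elim ([ ∉₁ , ∉₂ ]′ (inEither-elim eq))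
... | false = refl

-- Parking functions on K_{a*,q}

Positive : ℕ → (ℕ → ℕ) → Set
Positive N F = ∀ i → i < N → 1 ≤ F i

IncreasingOn : ℕ → ℕ → (ℕ → ℕ) → Set
IncreasingOn a N F = (∀ i j → i ≤ j → j < a → F i ≤ F j) × (∀ i j → a ≤ i → i ≤ j → j < N → F i ≤ F j)

-- F i is the value at v^p_{i+1} and F (a + j) the value at v^q_{j+1}.  This is the parking condition
-- on G^A, A = the first iA P- and first jA Q-vertices (box iA jA below), tested on the set S of the
-- v^p_{k+1} (i ≤ k < iA) and v^q_{k+1} (j ≤ k < jA): the least P-vertex of S has j neighbours in A ∖ S,
-- the least Q-vertex has i of them plus the sink.
BoxCondition : ℕ → ℕ → ℕ → (ℕ → ℕ) → Set
BoxCondition a iA jA F = ∀ i j → i ≤ iA → j ≤ jA → i < iA ⊎ j < jA →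
  (i < iA × F i ≤ j) ⊎ (j < jA × F (a + j) ≤ suc i)

intervals : ∀ {m} → ℕ → ℕ → ℕ → ℕ → Subset m
intervals lo hi lo′ hi′ = subset (inEither lo hi lo′ hi′)

module _ {m} (lo hi lo′ hi′ : ℕ) {u : Fin m} where

  ∈intervals⁻ : u ∈ intervals lo hi lo′ hi′ → (lo ≤ toℕ u × toℕ u < hi) ⊎ (lo′ ≤ toℕ u × toℕ u < hi′)
  ∈intervals⁻ u∈ = inEither-elim (∈-subset⁻ (inEither lo hi lo′ hi′) u∈)

  ∈intervals₁ : lo ≤ toℕ u → toℕ u < hi → u ∈ intervals lo hi lo′ hi′
  ∈intervals₁ lo≤u u<hi = ∈-subset⁺ (inEither lo hi lo′ hi′) (inEither-intro₁ lo≤u u<hi)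

  ∈intervals₂ : lo′ ≤ toℕ u → toℕ u < hi′ → u ∈ intervals lo hi lo′ hi′
  ∈intervals₂ lo′≤u u<hi′ = ∈-subset⁺ (inEither lo hi lo′ hi′) (inEither-intro₂ lo′≤u u<hi′)

  ∉intervals : ¬ (lo ≤ toℕ u × toℕ u < hi) → ¬ (lo′ ≤ toℕ u × toℕ u < hi′) → u ∈ ∁ (intervals lo hi lo′ hi′)
  ∉intervals ∉₁ ∉₂ = memberℕ⇒∉ (trans (sym (lookup≡memberℕ (intervals lo hi lo′ hi′) u))
    (trans (lookup∘tabulate _ u) (inEither-false ∉₁ ∉₂)))

module OnK (a q : ℕ) where

  N : ℕ
  N = a + q

  G : Graph
  G = K a q

  vertex : ∀ k → k < N → Fin N
  vertex k k<N = fromℕ< k<N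

  toℕ-vertex : ∀ k (k<N : k < N) → toℕ (vertex k k<N) ≡ k
  toℕ-vertex k k<N = toℕ-fromℕ< k<N

  at-vertex : ∀ {f F} → Represents f F → ∀ k (k<N : k < N) → f (vertex k k<N) ≡ F k
  at-vertex {F = F} rep k k<N = trans (sym (agrees rep (vertex k k<N))) (cong F (toℕ-vertex k k<N))

  private
    isP-below : ∀ (v : Fin N) → toℕ v < a → isP a (fs v) ≡ true
    isP-below v v<a = Equivalence.to T-≡ (≤⇒≤ᵇ v<a)

    isP-above : ∀ (v : Fin N) → a ≤ toℕ v → isP a (fs v) ≡ false
    isP-above v a≤v with isP a (fs v) in eq
    ... | false = refl
    ... | true  = ⊥-elim (<-irrefl refl (≤-trans (≤ᵇ⇒≤ (suc (toℕ v)) a (Equivalence.from T-≡ eq)) a≤v))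

  adjacent-PQ : ∀ v w → toℕ v < a → a ≤ toℕ w → mult G (fs v) (fs w) ≡ 1
  adjacent-PQ v w v<a a≤w rewrite isP-below v v<a | isP-above w a≤w = refl

  adjacent-QP : ∀ v w → a ≤ toℕ v → toℕ w < a → mult G (fs v) (fs w) ≡ 1
  adjacent-QP v w a≤v w<a rewrite isP-above v a≤v | isP-below w w<a = refl

  sink-P : ∀ v → toℕ v < a → mult G (fs v) fz ≡ 0
  sink-P v v<a rewrite isP-below v v<a = refl

  sink-Q : ∀ v → a ≤ toℕ v → mult G (fs v) fz ≡ 1
  sink-Q v a≤v rewrite isP-above v a≤v = refl

  simple : ∀ v w → mult G v w ≤ 1
  simple v w with isP a v xor isP a w
  ... | true  = ≤-refl
  ... | false = z≤n

  neighbour-of-P : ∀ v w → toℕ v < a → mult G (fs v) (fs w) ≡ 1 → a ≤ toℕ w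
  neighbour-of-P v w v<a adj with a ≤? toℕ w
  ... | yes a≤w = a≤w
  ... | no  a≰w rewrite isP-below v v<a | isP-below w (≰⇒> a≰w) with () ← adj

  neighbour-of-Q : ∀ v w → a ≤ toℕ v → mult G (fs v) (fs w) ≡ 1 → toℕ w < a
  neighbour-of-Q v w a≤v adj with toℕ w <? a
  ... | yes w<a = w<a
  ... | no  w≮a rewrite isP-above v a≤v | isP-above w (≮⇒≥ w≮a) with () ← adj

  degIn-P-lowerBound : ∀ T v → toℕ v < a → ∀ lo hi → a ≤ lo → lo ≤ hi → hi ≤ N →
    (∀ w → lo ≤ toℕ w → toℕ w < hi → w ∈ T) → hi ∸ lo ≤ degIn G T v
  degIn-P-lowerBound T v v<a lo hi a≤lo lo≤hi hi≤N inT = degIn-lowerBound G T v lo hi lo≤hi hi≤N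
    λ w lo≤w w<hi → inT w lo≤w w<hi , adjacent-PQ v w v<a (≤-trans a≤lo lo≤w)

  degIn-Q-lowerBound : ∀ T v → a ≤ toℕ v → ∀ lo hi → lo ≤ hi → hi ≤ a →
    (∀ w → lo ≤ toℕ w → toℕ w < hi → w ∈ T) → hi ∸ lo ≤ degIn G T v
  degIn-Q-lowerBound T v a≤v lo hi lo≤hi hi≤a inT = degIn-lowerBound G T v lo hi lo≤hi (≤-trans hi≤a (m≤m+n a q))
    λ w lo≤w w<hi → inT w lo≤w w<hi , adjacent-QP v w a≤v (<-≤-trans w<hi hi≤a)

  degIn-P-upperBound : ∀ T v → toℕ v < a → ∀ lo hi → lo ≤ hi → hi ≤ N →
    (∀ w → w ∈ T → a ≤ toℕ w → lo ≤ toℕ w × toℕ w < hi) → degIn G T v ≤ hi ∸ lo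
  degIn-P-upperBound T v v<a lo hi lo≤hi hi≤N inRange = degIn-upperBound G T v lo hi lo≤hi hi≤N (λ w → simple (fs v) (fs w))
    λ w w∈T adj → inRange w w∈T (neighbour-of-P v w v<a adj)

  degIn-Q-upperBound : ∀ T v → a ≤ toℕ v → ∀ lo hi → lo ≤ hi → hi ≤ N →
    (∀ w → w ∈ T → toℕ w < a → lo ≤ toℕ w × toℕ w < hi) → degIn G T v ≤ hi ∸ lo
  degIn-Q-upperBound T v a≤v lo hi lo≤hi hi≤N inRange = degIn-upperBound G T v lo hi lo≤hi hi≤N (λ w → simple (fs v) (fs w))
    λ w w∈T adj → inRange w w∈T (neighbour-of-Q v w a≤v adj)

  box : ℕ → ℕ → Subset N
  box i j = intervals 0 i a (a + j)

  ∈box⁻ : ∀ {i j u} → u ∈ box i j → toℕ u < i ⊎ (a ≤ toℕ u × toℕ u < a + j)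
  ∈box⁻ {i} {j} u∈ with ∈intervals⁻ 0 i a (a + j) u∈
  ... | inj₁ (_ , u<i) = inj₁ u<i
  ... | inj₂ u∈Q      = inj₂ u∈Q

  ∈box-P : ∀ {i j u} → toℕ u < i → u ∈ box i j
  ∈box-P {i} {j} = ∈intervals₁ 0 i a (a + j) z≤n

  ∈box-Q : ∀ {i j u} → a ≤ toℕ u → toℕ u < a + j → u ∈ box i j
  ∈box-Q {i} {j} = ∈intervals₂ 0 i a (a + j)

  ∉box : ∀ {i j u} → ¬ toℕ u < i → ¬ (a ≤ toℕ u × toℕ u < a + j) → u ∈ ∁ (box i j)
  ∉box {i} {j} u≮i = ∉intervals 0 i a (a + j) (λ (_ , u<i) → u≮i u<i)

  upSet : ℕ → ℕ → Subset N
  upSet i j = intervals i a (a + j) N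

  ∈upSet⁻ : ∀ {i j u} → u ∈ upSet i j → (i ≤ toℕ u × toℕ u < a) ⊎ a + j ≤ toℕ u
  ∈upSet⁻ {i} {j} u∈ with ∈intervals⁻ i a (a + j) N u∈
  ... | inj₁ u∈P        = inj₁ u∈P
  ... | inj₂ (a+j≤u , _) = inj₂ a+j≤u

  ∈upSet-P : ∀ {i j u} → i ≤ toℕ u → toℕ u < a → u ∈ upSet i j
  ∈upSet-P {i} {j} = ∈intervals₁ i a (a + j) N

  ∈upSet-Q : ∀ {i j u} → a + j ≤ toℕ u → u ∈ upSet i j
  ∈upSet-Q {i} {j} {u} a+j≤u = ∈intervals₂ i a (a + j) N a+j≤u (toℕ<n u)

  degOut-box-P : ∀ {iA jA} S v → toℕ v < a → ∀ j → j ≤ jA → jA ≤ q →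
                 (∀ k → k < j → memberℕ S (a + k) ≡ false) → j ≤ degOut G (box iA jA) S v
  degOut-box-P {iA} {jA} S v v<a j j≤jA jA≤q Q-outside-S = begin
    j                              ≡⟨ sym (m+n∸m≡n a j) ⟩
    (a + j) ∸ a                    ≤⟨ degIn-P-lowerBound _ v v<a a (a + j) ≤-refl (m≤m+n a j)
                                        (+-monoʳ-≤ a (≤-trans j≤jA jA≤q)) Q-in-box∖S ⟩
    degIn G (box iA jA ∩ ∁ S) v    ≤⟨ m≤n+m _ _ ⟩
    degOut G (box iA jA) S v       ∎
    where
    open ≤-Reasoning
    Q-in-box∖S : ∀ u → a ≤ toℕ u → toℕ u < a + j → u ∈ box iA jA ∩ ∁ S
    Q-in-box∖S u a≤u u<a+j = x∈p∩q⁺ (∈box-Q a≤u (<-≤-trans u<a+j (+-monoʳ-≤ a j≤jA)) , memberℕ⇒∉ u∉S)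
      where
      a+[u∸a]≡u : a + (toℕ u ∸ a) ≡ toℕ u
      a+[u∸a]≡u = m+[n∸m]≡n a≤u
      u∉S : memberℕ S (toℕ u) ≡ false
      u∉S = subst (λ k → memberℕ S k ≡ false) a+[u∸a]≡u
              (Q-outside-S (toℕ u ∸ a) (+-cancelˡ-< a _ _ (subst (_< a + j) (sym a+[u∸a]≡u) u<a+j)))

  degOut-box-Q : ∀ {iA jA} S v → a ≤ toℕ v → ∀ i → i ≤ iA → iA ≤ a →
                 (∀ k → k < i → memberℕ S k ≡ false) → suc i ≤ degOut G (box iA jA) S v
  degOut-box-Q {iA} {jA} S v a≤v i i≤iA iA≤a P-outside-S = begin
    suc (i ∸ 0)                         ≤⟨ s≤s (degIn-Q-lowerBound _ v a≤v 0 i z≤n (≤-trans i≤iA iA≤a) P-in-box∖S) ⟩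
    suc (degIn G (box iA jA ∩ ∁ S) v)   ≡⟨ cong (_+ degIn G (box iA jA ∩ ∁ S) v) (sym (sink-Q v a≤v)) ⟩
    degOut G (box iA jA) S v            ∎
    where
    open ≤-Reasoning
    P-in-box∖S : ∀ u → 0 ≤ toℕ u → toℕ u < i → u ∈ box iA jA ∩ ∁ S
    P-in-box∖S u _ u<i = x∈p∩q⁺ (∈box-P (<-≤-trans u<i i≤iA) , memberℕ⇒∉ (P-outside-S (toℕ u) u<i))

  box-parking : ∀ {f F} → Represents f F → ∀ iA jA → iA ≤ a → jA ≤ q →
    Positive N F → BoxCondition a iA jA F → IsPFOn G (box iA jA) f
  box-parking {f} {F} rep iA jA iA≤a jA≤q positive condition = positive-on-box , parking
    where
    positive-on-box : ∀ v → v ∈ box iA jA → 1 ≤ f v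
    positive-on-box v _ = subst (1 ≤_) (agrees rep v) (positive (toℕ v) (toℕ<n v))
    parking : ∀ S → S ⊆ box iA jA → Nonempty S → ∃ λ v → v ∈ S × f v ≤ degOut G (box iA jA) S v
    parking S S⊆box (w , w∈S) = least (condition i₀ j₀ (firstTrue-≤ inS iA) (firstTrue-≤ inSQ jA) some-least)
      where
      inS inSQ : ℕ → Bool
      inS  = memberℕ S
      inSQ = λ k → memberℕ S (a + k)
      i₀ j₀ : ℕ
      i₀ = firstTrue inS iA
      j₀ = firstTrue inSQ jA
      some-least : i₀ < iA ⊎ j₀ < jA
      some-least with ∈box⁻ (S⊆box w∈S)
      ... | inj₁ w<iA = inj₁ (≤-<-trans (firstTrue-minimal inS iA (toℕ w) (∈⇒memberℕ w∈S)) w<iA)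
      ... | inj₂ (a≤w , w<) = inj₂ (≤-<-trans (firstTrue-minimal inSQ jA (toℕ w ∸ a) w∈S′)
                                              (+-cancelˡ-< a _ _ (subst (_< a + jA) (sym a+[w∸a]≡w) w<)))
        where
        a+[w∸a]≡w : a + (toℕ w ∸ a) ≡ toℕ w
        a+[w∸a]≡w = m+[n∸m]≡n a≤w
        w∈S′ : inSQ (toℕ w ∸ a) ≡ true
        w∈S′ = subst (λ k → memberℕ S k ≡ true) (sym a+[w∸a]≡w) (∈⇒memberℕ w∈S)
      least : (i₀ < iA × F i₀ ≤ j₀) ⊎ (j₀ < jA × F (a + j₀) ≤ suc i₀) →
              ∃ λ v → v ∈ S × f v ≤ degOut G (box iA jA) S v
      least (inj₁ (i₀<iA , F[i₀]≤j₀)) = vertex i₀ i₀<N , v∈S , (begin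
        f (vertex i₀ i₀<N)                  ≡⟨ at-vertex rep i₀ i₀<N ⟩
        F i₀                                ≤⟨ F[i₀]≤j₀ ⟩
        j₀                                  ≤⟨ degOut-box-P S _ v<a j₀ (firstTrue-≤ inSQ jA) jA≤q (firstTrue-before inSQ jA) ⟩
        degOut G (box iA jA) S _            ∎)
        where
        open ≤-Reasoning
        i₀<N : i₀ < N
        i₀<N = ≤-trans i₀<iA (≤-trans iA≤a (m≤m+n a q))
        v<a : toℕ (vertex i₀ i₀<N) < a
        v<a = subst (_< a) (sym (toℕ-vertex i₀ i₀<N)) (≤-trans i₀<iA iA≤a)
        v∈S : vertex i₀ i₀<N ∈ S
        v∈S = memberℕ⇒∈ (subst (λ k → memberℕ S k ≡ true) (sym (toℕ-vertex i₀ i₀<N)) (firstTrue-at inS iA i₀<iA))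
      least (inj₂ (j₀<jA , F[a+j₀]≤1+i₀)) = vertex (a + j₀) a+j₀<N , v∈S , (begin
        f (vertex (a + j₀) a+j₀<N)          ≡⟨ at-vertex rep (a + j₀) a+j₀<N ⟩
        F (a + j₀)                          ≤⟨ F[a+j₀]≤1+i₀ ⟩
        suc i₀                              ≤⟨ degOut-box-Q S _ a≤v i₀ (firstTrue-≤ inS iA) iA≤a (firstTrue-before inS iA) ⟩
        degOut G (box iA jA) S _            ∎)
        where
        open ≤-Reasoning
        a+j₀<N : a + j₀ < N
        a+j₀<N = +-monoʳ-< a (≤-trans j₀<jA jA≤q)
        a≤v : a ≤ toℕ (vertex (a + j₀) a+j₀<N)
        a≤v = subst (a ≤_) (sym (toℕ-vertex (a + j₀) a+j₀<N)) (m≤m+n a j₀)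
        v∈S : vertex (a + j₀) a+j₀<N ∈ S
        v∈S = memberℕ⇒∈ (subst (λ k → memberℕ S k ≡ true) (sym (toℕ-vertex (a + j₀) a+j₀<N)) (firstTrue-at inSQ jA j₀<jA))

  degOut-upSet-P : ∀ {i j} v → toℕ v < a → j ≤ q → degOut G ⊤ (upSet i j) v ≤ j
  degOut-upSet-P {i} {j} v v<a j≤q = begin
    degOut G ⊤ (upSet i j) v             ≡⟨ cong (_+ degIn G (⊤ ∩ ∁ (upSet i j)) v) (sink-P v v<a) ⟩
    degIn G (⊤ ∩ ∁ (upSet i j)) v        ≤⟨ degIn-P-upperBound _ v v<a a (a + j) (m≤m+n a j) (+-monoʳ-≤ a j≤q) Q-outside ⟩
    (a + j) ∸ a                          ≡⟨ m+n∸m≡n a j ⟩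
    j                                    ∎
    where
    open ≤-Reasoning
    Q-outside : ∀ u → u ∈ ⊤ ∩ ∁ (upSet i j) → a ≤ toℕ u → a ≤ toℕ u × toℕ u < a + j
    Q-outside u u∉ a≤u = a≤u , ≰⇒> (λ a+j≤u → x∈∁p⇒x∉p (proj₂ (x∈p∩q⁻ ⊤ _ u∉)) (∈upSet-Q a+j≤u))

  degOut-upSet-Q : ∀ {i j} v → a ≤ toℕ v → i ≤ a → degOut G ⊤ (upSet i j) v ≤ suc i
  degOut-upSet-Q {i} {j} v a≤v i≤a = begin
    degOut G ⊤ (upSet i j) v             ≡⟨ cong (_+ degIn G (⊤ ∩ ∁ (upSet i j)) v) (sink-Q v a≤v) ⟩
    suc (degIn G (⊤ ∩ ∁ (upSet i j)) v)  ≤⟨ s≤s (degIn-Q-upperBound _ v a≤v 0 i z≤n (≤-trans i≤a (m≤m+n a q)) P-outside) ⟩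
    suc (i ∸ 0)                          ∎
    where
    open ≤-Reasoning
    P-outside : ∀ u → u ∈ ⊤ ∩ ∁ (upSet i j) → toℕ u < a → 0 ≤ toℕ u × toℕ u < i
    P-outside u u∉ u<a = z≤n , ≰⇒> (λ i≤u → x∈∁p⇒x∉p (proj₂ (x∈p∩q⁻ ⊤ _ u∉)) (∈upSet-P i≤u u<a))

  parking⇒boxCondition : ∀ {f F} → Represents f F → IsPF G f → IncreasingOn a N F → BoxCondition a a q F
  parking⇒boxCondition {f} {F} rep (_ , parking) (inc-P , inc-Q) i j i≤a j≤q some =
    least (parking (upSet i j) (λ _ → ∈⊤) (nonempty some))
    where
    nonempty : i < a ⊎ j < q → Nonempty (upSet i j)
    nonempty (inj₁ i<a) = vertex i i<N , ∈upSet-P (≤-reflexive (sym (toℕ-vertex i i<N))) (subst (_< a) (sym (toℕ-vertex i i<N)) i<a)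
      where i<N = ≤-trans i<a (m≤m+n a q)
    nonempty (inj₂ j<q) = vertex (a + j) a+j<N , ∈upSet-Q (≤-reflexive (sym (toℕ-vertex (a + j) a+j<N)))
      where a+j<N = +-monoʳ-< a j<q
    least : (∃ λ v → v ∈ upSet i j × f v ≤ degOut G ⊤ (upSet i j) v) →
            (i < a × F i ≤ j) ⊎ (j < q × F (a + j) ≤ suc i)
    least (v , v∈ , f[v]≤) with ∈upSet⁻ v∈
    ... | inj₁ (i≤v , v<a) = inj₁ (≤-<-trans i≤v v<a , (begin
      F i                       ≤⟨ inc-P i (toℕ v) i≤v v<a ⟩
      F (toℕ v)                 ≡⟨ agrees rep v ⟩
      f v                       ≤⟨ f[v]≤ ⟩
      degOut G ⊤ (upSet i j) v  ≤⟨ degOut-upSet-P v v<a j≤q ⟩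
      j                         ∎))
      where open ≤-Reasoning
    ... | inj₂ a+j≤v = inj₂ (+-cancelˡ-< a j q (≤-<-trans a+j≤v (toℕ<n v)) , (begin
      F (a + j)                 ≤⟨ inc-Q (a + j) (toℕ v) (m≤m+n a j) a+j≤v (toℕ<n v) ⟩
      F (toℕ v)                 ≡⟨ agrees rep v ⟩
      f v                       ≤⟨ f[v]≤ ⟩
      degOut G ⊤ (upSet i j) v  ≤⟨ degOut-upSet-Q v (≤-trans (m≤m+n a j) a+j≤v) i≤a ⟩
      suc i                     ∎))
      where open ≤-Reasoning

  ⊤≡box : ⊤ ≡ box a q
  ⊤≡box = trans (sym (tabulate∘lookup ⊤)) (tabulate-cong λ u → trans (lookup-⊤ u) (sym (everywhere u)))
    where
    everywhere : ∀ u → inEither 0 a a (a + q) (toℕ u) ≡ true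
    everywhere u = covered (toℕ u <? a)
      where
      covered : Dec (toℕ u < a) → inEither 0 a a (a + q) (toℕ u) ≡ true
      covered (yes u<a) = inEither-intro₁ z≤n u<a
      covered (no  u≮a) = inEither-intro₂ (≮⇒≥ u≮a) (toℕ<n u)

  boxCondition⇒parking : ∀ {f F} → Represents f F → Positive N F → BoxCondition a a q F → IsPF G f
  boxCondition⇒parking {f} rep positive condition =
    subst (λ A → IsPFOn G A f) (sym ⊤≡box) (box-parking rep a q ≤-refl ≤-refl positive condition)

  parking⇒positive : ∀ {f F} → Represents f F → IsPF G f → Positive N F
  parking⇒positive rep (positive , _) k k<N = subst (1 ≤_) (at-vertex rep k k<N) (positive (vertex k k<N) ∈⊤)

  boxCondition-restrict : ∀ {F i j} → i ≤ a → j ≤ q → (i < a → j < F i) → (j < q → i < F (a + j)) →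
                          BoxCondition a a q F → BoxCondition a i j F
  boxCondition-restrict {F} {i} {j} i≤a j≤q P-steep Q-steep condition i′ j′ i′≤i j′≤j some
    with condition i′ j′ (≤-trans i′≤i i≤a) (≤-trans j′≤j j≤q)
                   (⊎-map (λ i′<i → <-≤-trans i′<i i≤a) (λ j′<j → <-≤-trans j′<j j≤q) some)
  ... | inj₁ (i′<a , F[i′]≤j′) with i′ <? i
  ...   | yes i′<i = inj₁ (i′<i , F[i′]≤j′)
  ...   | no  i′≮i = ⊥-elim (<-irrefl refl (<-≤-trans (P-steep (subst (_< a) i′≡i i′<a))
                                                        (subst (λ k → F k ≤ j) i′≡i (≤-trans F[i′]≤j′ j′≤j))))
    where i′≡i = ≤-antisym i′≤i (≮⇒≥ i′≮i)
  boxCondition-restrict {F} {i} {j} i≤a j≤q P-steep Q-steep condition i′ j′ i′≤i j′≤j some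
    | inj₂ (j′<q , F[a+j′]≤1+i′) with j′ <? j
  ...   | yes j′<j = inj₂ (j′<j , F[a+j′]≤1+i′)
  ...   | no  j′≮j = ⊥-elim (<-irrefl refl (≤-trans (Q-steep (subst (_< q) j′≡j j′<q))
                                                    (subst (λ k → F (a + k) ≤ i) j′≡j (≤-trans F[a+j′]≤1+i′ i′<i))))
    where
    j′≡j : j′ ≡ j
    j′≡j = ≤-antisym j′≤j (≮⇒≥ j′≮j)
    i′<i : i′ < i
    i′<i = [ id , (λ j′<j → ⊥-elim (j′≮j j′<j)) ]′ some

  box-nonempty : ∀ {i j} → i ≤ a → j ≤ q → 0 < i ⊎ 0 < j → Nonempty (box i j)
  box-nonempty i≤a j≤q (inj₁ 0<i) = vertex 0 0<N , ∈box-P (subst (_< _) (sym (toℕ-vertex 0 0<N)) 0<i)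
    where 0<N = <-≤-trans 0<i (≤-trans i≤a (m≤m+n a q))
  box-nonempty {j = j} i≤a j≤q (inj₂ 0<j) =
    vertex a a<N , ∈box-Q (≤-reflexive (sym (toℕ-vertex a a<N))) (subst (_< a + j) (sym (toℕ-vertex a a<N)) a<a+j)
    where
    a<a+j : a < a + j
    a<a+j = subst (_< a + j) (+-identityʳ a) (+-monoʳ-< a 0<j)
    a<N : a < N
    a<N   = <-≤-trans a<a+j (+-monoʳ-≤ a j≤q)

  box-co-nonempty : ∀ {i j} → i ≤ a → i < a ⊎ j < q → Nonempty (∁ (box i j))
  box-co-nonempty i≤a (inj₁ i<a) = vertex _ i<N , ∉box (λ v<i → <-irrefl (toℕ-vertex _ i<N) v<i)
                                                       (λ (a≤v , _) → <-irrefl refl (<-≤-trans i<a (subst (a ≤_) (toℕ-vertex _ i<N) a≤v)))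
    where i<N = ≤-trans i<a (m≤m+n a q)
  box-co-nonempty {j = j} i≤a (inj₂ j<q) =
    vertex (a + j) a+j<N , ∉box (λ v<i → <-irrefl refl (<-≤-trans (subst (_< _) (toℕ-vertex _ a+j<N) v<i) (≤-trans i≤a (m≤m+n a j))))
                                (λ (_ , v<a+j) → <-irrefl (toℕ-vertex _ a+j<N) v<a+j)
    where a+j<N = +-monoʳ-< a j<q

  box-complement-positive : ∀ {f F} → Represents f F → ∀ {i j} → i ≤ a → j ≤ q → IncreasingOn a N F →
    (i < a → j < F i) → (j < q → i < F (a + j)) →
    ∀ v → v ∈ ∁ (box i j) → 1 ≤ f v ∸ degIn G (box i j) v
  box-complement-positive {f} {F} rep {i} {j} i≤a j≤q (inc-P , inc-Q) P-steep Q-steep v v∉box = n≢0⇒n>0 (m>n⇒m∸n≢0 (v-side (toℕ v <? a)))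
    where
    v∉ : ¬ v ∈ box i j
    v∉ = x∈∁p⇒x∉p v∉box
    v-side : Dec (toℕ v < a) → degIn G (box i j) v < f v
    v-side (yes v<a) = begin-strict
      degIn G (box i j) v   ≤⟨ degIn-P-upperBound _ v v<a a (a + j) (m≤m+n a j) (+-monoʳ-≤ a j≤q) Q-in-box ⟩
      (a + j) ∸ a           ≡⟨ m+n∸m≡n a j ⟩
      j                     <⟨ P-steep (≤-<-trans i≤v v<a) ⟩
      F i                   ≤⟨ inc-P i (toℕ v) i≤v v<a ⟩
      F (toℕ v)             ≡⟨ agrees rep v ⟩
      f v                   ∎
      where
      open ≤-Reasoning
      i≤v : i ≤ toℕ v
      i≤v = ≮⇒≥ (λ v<i → v∉ (∈box-P v<i))
      Q-in-box : ∀ u → u ∈ box i j → a ≤ toℕ u → a ≤ toℕ u × toℕ u < a + j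
      Q-in-box u u∈ a≤u = [ (λ u<i → ⊥-elim (<-irrefl refl (<-≤-trans u<i (≤-trans i≤a a≤u)))) , id ]′ (∈box⁻ u∈)
    v-side (no v≮a) = begin-strict
      degIn G (box i j) v   ≤⟨ degIn-Q-upperBound _ v a≤v 0 i z≤n (≤-trans i≤a (m≤m+n a q)) P-in-box ⟩
      i                     <⟨ Q-steep (+-cancelˡ-< a j q (≤-<-trans a+j≤v (toℕ<n v))) ⟩
      F (a + j)             ≤⟨ inc-Q (a + j) (toℕ v) (m≤m+n a j) a+j≤v (toℕ<n v) ⟩
      F (toℕ v)             ≡⟨ agrees rep v ⟩
      f v                   ∎
      where
      open ≤-Reasoning
      a≤v : a ≤ toℕ v
      a≤v = ≮⇒≥ v≮a
      a+j≤v : a + j ≤ toℕ v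
      a+j≤v = ≮⇒≥ (λ v<a+j → v∉ (∈box-Q a≤v v<a+j))
      P-in-box : ∀ u → u ∈ box i j → toℕ u < a → 0 ≤ toℕ u × toℕ u < i
      P-in-box u u∈ u<a = z≤n , [ id , (λ (a≤u , _) → ⊥-elim (<-irrefl refl (<-≤-trans u<a a≤u))) ]′ (∈box⁻ u∈)

  decomposable-at-box : ∀ {f F} → Represents f F → ∀ {i j} → IsPF G f → IncreasingOn a N F → i ≤ a → j ≤ q →
    (i < a → j < F i) → (j < q → i < F (a + j)) → Decomposable G f (box i j)
  decomposable-at-box {f} rep {i} {j} pf inc i≤a j≤q P-steep Q-steep =
    box-parking rep i j i≤a j≤q (parking⇒positive rep pf)
      (boxCondition-restrict i≤a j≤q P-steep Q-steep (parking⇒boxCondition rep pf inc)) ,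
    box-complement-positive rep i≤a j≤q inc P-steep Q-steep ,
    (λ S _ → complement-parking G f pf (box i j) S)

  increasing⇒IncreasingOn : ∀ {f F} → Represents f F → Increasing a q f → IncreasingOn a N F
  increasing⇒IncreasingOn {f} {F} rep (inc-P , inc-Q) = P-part , Q-part
    where
    at : ∀ k (k<N : k < N) → f (vertex k k<N) ≡ F k
    at = at-vertex rep
    P-part : ∀ i j → i ≤ j → j < a → F i ≤ F j
    P-part i j i≤j j<a = subst₂ _≤_ (at i i<N) (at j j<N)
      (inc-P (vertex i i<N) (vertex j j<N) (subst₂ _≤_ (sym (toℕ-vertex i i<N)) (sym (toℕ-vertex j j<N)) i≤j)
             (subst (_< a) (sym (toℕ-vertex j j<N)) j<a))
      where
      j<N : j < N
      j<N = ≤-trans j<a (m≤m+n a q)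
      i<N : i < N
      i<N = ≤-<-trans i≤j j<N
    Q-part : ∀ i j → a ≤ i → i ≤ j → j < N → F i ≤ F j
    Q-part i j a≤i i≤j j<N = subst₂ _≤_ (at i i<N) (at j j<N)
      (inc-Q (vertex i i<N) (vertex j j<N) (subst (a ≤_) (sym (toℕ-vertex i i<N)) a≤i)
             (subst₂ _≤_ (sym (toℕ-vertex i i<N)) (sym (toℕ-vertex j j<N)) i≤j))
      where i<N = ≤-<-trans i≤j j<N

  IncreasingOn⇒increasing : ∀ {f F} → Represents f F → IncreasingOn a N F → Increasing a q f
  IncreasingOn⇒increasing rep (inc-P , inc-Q) =
    (λ i j i≤j j<a → subst₂ _≤_ (agrees rep i) (agrees rep j) (inc-P (toℕ i) (toℕ j) i≤j j<a)) ,
    (λ i j a≤i i≤j → subst₂ _≤_ (agrees rep i) (agrees rep j) (inc-Q (toℕ i) (toℕ j) a≤i i≤j (toℕ<n j)))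

-- Prime parking functions on K_{(a+1)*,q}

module PrimeOnK (a q : ℕ) (1≤q : 1 ≤ q) where
  open OnK (suc a) q

  prime⇒no-steep-box : ∀ {f F} → Represents f F → IsPPF G f → IncreasingOn (suc a) N F →
    ∀ i j → i ≤ suc a → j ≤ q → 0 < i ⊎ 0 < j → i < suc a ⊎ j < q →
    (i < suc a → j < F i) → (j < q → i < F (suc a + j)) → ⊥
  prime⇒no-steep-box rep (pf , prime) inc i j i≤ j≤q nonempty proper P-steep Q-steep =
    prime (box i j) (box-nonempty i≤ j≤q nonempty) (box-co-nonempty i≤ proper)
          (decomposable-at-box rep pf inc i≤ j≤q P-steep Q-steep)

  prime⇒first-value : ∀ {f F} → Represents f F → IsPPF G f → IncreasingOn (suc a) N F → F 0 ≡ 1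
  prime⇒first-value {F = F} rep ppf inc with F 0 ≟ 1
  ... | yes F[0]≡1 = F[0]≡1
  ... | no  F[0]≢1 = ⊥-elim (prime⇒no-steep-box rep ppf inc 0 1 z≤n 1≤q (inj₂ z<s) (inj₁ z<s)
        (λ _ → ≤∧≢⇒< (parking⇒positive rep (proj₁ ppf) 0 z<s) (F[0]≢1 ∘ sym))
        (λ j<q → parking⇒positive rep (proj₁ ppf) (suc a + 1) (+-monoʳ-< (suc a) j<q)))

  prime⇒tail-condition : ∀ {f F} → Represents f F → IsPPF G f → IncreasingOn (suc a) N F →
    BoxCondition a a q (F ∘ suc)
  prime⇒tail-condition {F = F} rep ppf inc i j i≤a j≤q some
    with (i <? a) ×-dec (F (suc i) ≤? j) | (j <? q) ×-dec (F (suc a + j) ≤? suc i)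
  ... | yes P-parks | _          = inj₁ P-parks
  ... | no  _       | yes Q-parks = inj₂ Q-parks
  ... | no  P-fails | no  Q-fails = ⊥-elim (prime⇒no-steep-box rep ppf inc (suc i) j (s≤s i≤a) j≤q (inj₁ z<s)
      (⊎-map s≤s id some)
      (λ 1+i<1+a → ≰⇒> (λ F≤j → P-fails (s≤s⁻¹ 1+i<1+a , F≤j)))
      (λ j<q → ≰⇒> (λ F≤1+i → Q-fails (j<q , F≤1+i))))

  1+a<N : suc a < N
  1+a<N = subst (_< N) (+-identityʳ (suc a)) (+-monoʳ-< (suc a) 1≤q)

  tail-condition-first-Q : ∀ {F} → Positive N F → BoxCondition a a q (F ∘ suc) → F (suc a + 0) ≤ 1
  tail-condition-first-Q {F} positive tail = first-Q (tail 0 0 z≤n z≤n (inj₂ 1≤q))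
    where
    first-Q : (0 < a × F 1 ≤ 0) ⊎ (0 < q × F (suc a + 0) ≤ 1) → F (suc a + 0) ≤ 1
    first-Q (inj₁ (_ , F[1]≤0))   = ⊥-elim (<-irrefl refl (≤-trans (positive 1 (<-≤-trans (s≤s z<s) 1+a<N)) F[1]≤0))
    first-Q (inj₂ (_ , F[1+a]≤1)) = F[1+a]≤1

  boxCondition-cons : ∀ {F} → F 0 ≡ 1 → F (suc a + 0) ≤ 1 → BoxCondition a a q (F ∘ suc) →
                      BoxCondition (suc a) (suc a) q F
  boxCondition-cons F[0]≡1 F[1+a]≤1 tail zero    zero    _ _ _ = inj₂ (1≤q , F[1+a]≤1)
  boxCondition-cons F[0]≡1 F[1+a]≤1 tail zero    (suc j) _ _ _ = inj₁ (z<s , subst (_≤ suc j) (sym F[0]≡1) (s≤s z≤n))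
  boxCondition-cons F[0]≡1 F[1+a]≤1 tail (suc i) j i≤ j≤q some
    with tail i j (s≤s⁻¹ i≤) j≤q (⊎-map s≤s⁻¹ id some)
  ... | inj₁ (i<a , F≤j)   = inj₁ (s≤s i<a , F≤j)
  ... | inj₂ (j<q , F≤1+i) = inj₂ (j<q , m≤n⇒m≤1+n F≤1+i)

  module _ {f : Fin N → ℕ} {F : ℕ → ℕ} (rep : Represents f F) (F[0]≡1 : F 0 ≡ 1)
           (tail : BoxCondition a a q (F ∘ suc)) (positive : Positive N F) (A : Subset N)
           (outside : ∀ v → v ∈ ∁ A → degIn G A v < f v) where

    private
      inA : ℕ → Bool
      inA = memberℕ A

      vertex∉ : ∀ k (k<N : k < N) → inA k ≡ false → vertex k k<N ∈ ∁ A
      vertex∉ k k<N eq = memberℕ⇒∉ (subst (λ i → inA i ≡ false) (sym (toℕ-vertex k k<N)) eq)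

      outside-value : ∀ k (k<N : k < N) → inA k ≡ false → degIn G A (vertex k k<N) < F k
      outside-value k k<N eq = subst (_ <_) (at-vertex rep k k<N) (outside _ (vertex∉ k k<N eq))

      F[1+a]≤1 : F (suc a + 0) ≤ 1
      F[1+a]≤1 = tail-condition-first-Q positive tail

      no-neighbours : ∀ v → v ∈ ∁ A → F (toℕ v) ≤ 1 → ∀ u → u ∈ A → mult G (fs v) (fs u) ≡ 1 → ⊥
      no-neighbours v v∉A F[v]≤1 u u∈A adj = <-irrefl refl (begin-strict
        1             ≤⟨ degIn-adjacent G A v u u∈A adj ⟩
        degIn G A v   <⟨ outside v v∉A ⟩
        f v           ≡⟨ sym (agrees rep v) ⟩
        F (toℕ v)     ≤⟨ F[v]≤1 ⟩
        1             ∎)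
        where open ≤-Reasoning

    -- If v^p_1 were outside A then, as f(v^p_1) = 1, no neighbour of v^p_1 (no Q-vertex) lies in A;
    -- then v^q_1 is outside A with f(v^q_1) ≤ 1, so no P-vertex lies in A either.
    first-P-in-A : Nonempty A → vertex 0 z<s ∈ A
    first-P-in-A (w , w∈A) with vertex 0 z<s ∈? A
    ... | yes P₀∈A = P₀∈A
    ... | no  P₀∉A = ⊥-elim (side w∈A (toℕ w <? suc a))
      where
      P₀ Q₀ : Fin N
      P₀ = vertex 0 z<s
      Q₀ = vertex (suc a) 1+a<N
      no-Q : ∀ u → u ∈ A → suc a ≤ toℕ u → ⊥
      no-Q u u∈A 1+a≤u = no-neighbours P₀ (x∉p⇒x∈∁p P₀∉A) (≤-reflexive F[0]≡1) u u∈A (adjacent-PQ P₀ u z<s 1+a≤u)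
      1+a≤Q₀ : suc a ≤ toℕ Q₀
      1+a≤Q₀ = ≤-reflexive (sym (toℕ-vertex (suc a) 1+a<N))
      no-P : ∀ u → u ∈ A → toℕ u < suc a → ⊥
      no-P u u∈A u<1+a = no-neighbours Q₀ (x∉p⇒x∈∁p (λ Q₀∈A → no-Q Q₀ Q₀∈A 1+a≤Q₀))
        (subst (λ k → F k ≤ 1) (trans (+-identityʳ (suc a)) (sym (toℕ-vertex (suc a) 1+a<N))) F[1+a]≤1)
        u u∈A (adjacent-QP Q₀ u 1+a≤Q₀ u<1+a)
      side : ∀ {u} → u ∈ A → Dec (toℕ u < suc a) → ⊥
      side {u} u∈A (yes u<1+a) = no-P u u∈A u<1+a
      side {u} u∈A (no  u≮1+a) = no-Q u u∈A (≮⇒≥ u≮1+a)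

    -- v^p_{i′+2} is the first P-vertex and v^q_{j₀+1} the first Q-vertex outside A
    -- (i′ = a, resp. j₀ = q, if there is none).
    private
      i′ j₀ : ℕ
      i′ = firstTrue (λ k → not (inA (suc k))) a
      j₀ = firstTrue (λ k → not (inA (suc a + k))) q

      P-before : Nonempty A → ∀ k → k < suc i′ → inA k ≡ true
      P-before A≠∅ zero    _          = ∈⇒memberℕ (first-P-in-A A≠∅)
      P-before A≠∅ (suc k) (s≤s k<i′) = not-injective (firstTrue-before (λ k → not (inA (suc k))) a k k<i′)

      Q-before : ∀ k → k < j₀ → inA (suc a + k) ≡ true
      Q-before k k<j₀ = not-injective (firstTrue-before (λ k → not (inA (suc a + k))) q k k<j₀)

      P-first-out : i′ < a → inA (suc i′) ≡ false
      P-first-out i′<a = not-injective (firstTrue-at (λ k → not (inA (suc k))) a i′<a)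

      Q-first-out : j₀ < q → inA (suc a + j₀) ≡ false
      Q-first-out j₀<q = not-injective (firstTrue-at (λ k → not (inA (suc a + k))) q j₀<q)

      P-index-out : Nonempty A → ∀ k → k < suc a → inA k ≡ false → i′ < a
      P-index-out A≠∅ zero    _   out with () ← trans (sym (P-before A≠∅ 0 z<s)) out
      P-index-out A≠∅ (suc k) k<  out = ≤-<-trans (firstTrue-minimal _ a k (cong not out)) (s≤s⁻¹ k<)

      Q-index-out : ∀ k → k < q → inA (suc a + k) ≡ false → j₀ < q
      Q-index-out k k<q out = ≤-<-trans (firstTrue-minimal _ q k (cong not out)) k<q

      some-first-out : Nonempty A → Nonempty (∁ A) → i′ < a ⊎ j₀ < q
      some-first-out A≠∅ (w , w∉A) = side (toℕ w <? suc a)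
        where
        side : Dec (toℕ w < suc a) → i′ < a ⊎ j₀ < q
        side (yes w<1+a) = inj₁ (P-index-out A≠∅ (toℕ w) w<1+a (∉⇒memberℕ w∉A))
        side (no  w≮1+a) = inj₂ (Q-index-out (toℕ w ∸ suc a) k<q
                                   (subst (λ i → inA i ≡ false) (sym 1+a+k≡w) (∉⇒memberℕ w∉A)))
          where
          1+a+k≡w : suc a + (toℕ w ∸ suc a) ≡ toℕ w
          1+a+k≡w = m+[n∸m]≡n (≮⇒≥ w≮1+a)
          k<q : toℕ w ∸ suc a < q
          k<q = +-cancelˡ-< (suc a) _ _ (subst (_< N) (sym 1+a+k≡w) (toℕ<n w))

    -- The tail condition at (i′, j₀) yields a vertex outside A whose value is at most its
    -- number of neighbours in A, i.e. a non-positive value of f^B.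
    not-decomposable : Nonempty A → Nonempty (∁ A) → ⊥
    not-decomposable A≠∅ A≠V with tail i′ j₀ (firstTrue-≤ _ a) (firstTrue-≤ _ q) (some-first-out A≠∅ A≠V)
    ... | inj₁ (i′<a , F≤j₀) = <-irrefl refl (begin-strict
      j₀             ≡⟨ sym (m+n∸m≡n (suc a) j₀) ⟩
      (suc a + j₀) ∸ suc a
        ≤⟨ degIn-P-lowerBound A v v<1+a (suc a) (suc a + j₀) ≤-refl (m≤m+n _ _)
             (+-monoʳ-≤ (suc a) (firstTrue-≤ _ q)) Q-in ⟩
      degIn G A v    <⟨ outside-value (suc i′) 1+i′<N (P-first-out i′<a) ⟩
      F (suc i′)     ≤⟨ F≤j₀ ⟩
      j₀             ∎)
      where
      open ≤-Reasoning
      1+i′<N : suc i′ < N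
      1+i′<N = ≤-trans (s≤s i′<a) (m≤m+n (suc a) q)
      v : Fin N
      v = vertex (suc i′) 1+i′<N
      v<1+a : toℕ v < suc a
      v<1+a = subst (_< suc a) (sym (toℕ-vertex _ 1+i′<N)) (s≤s i′<a)
      Q-in : ∀ u → suc a ≤ toℕ u → toℕ u < suc a + j₀ → u ∈ A
      Q-in u 1+a≤u u< = memberℕ⇒∈ (subst (λ i → inA i ≡ true) 1+a+k≡u
        (Q-before (toℕ u ∸ suc a) (+-cancelˡ-< (suc a) _ _ (subst (_< suc a + j₀) (sym 1+a+k≡u) u<))))
        where 1+a+k≡u = m+[n∸m]≡n 1+a≤u
    ... | inj₂ (j₀<q , F≤1+i′) = <-irrefl refl (begin-strict
      suc i′         ≤⟨ degIn-Q-lowerBound A v 1+a≤v 0 (suc i′) z≤n (s≤s (firstTrue-≤ _ a)) P-in ⟩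
      degIn G A v    <⟨ outside-value (suc a + j₀) 1+a+j₀<N (Q-first-out j₀<q) ⟩
      F (suc a + j₀) ≤⟨ F≤1+i′ ⟩
      suc i′         ∎)
      where
      open ≤-Reasoning
      1+a+j₀<N : suc a + j₀ < N
      1+a+j₀<N = +-monoʳ-< (suc a) j₀<q
      v : Fin N
      v = vertex (suc a + j₀) 1+a+j₀<N
      1+a≤v : suc a ≤ toℕ v
      1+a≤v = subst (suc a ≤_) (sym (toℕ-vertex _ 1+a+j₀<N)) (m≤m+n (suc a) j₀)
      P-in : ∀ u → 0 ≤ toℕ u → toℕ u < suc i′ → u ∈ A
      P-in u _ u< = memberℕ⇒∈ (P-before A≠∅ (toℕ u) u<)

  tail-condition⇒prime : ∀ {f F} → Represents f F → F 0 ≡ 1 → Positive N F → BoxCondition a a q (F ∘ suc) →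
                         IsPPF G f
  tail-condition⇒prime {f} rep F[0]≡1 positive tail = parking , λ A A≠∅ A≠V (_ , B-positive , _) →
    not-decomposable rep F[0]≡1 tail positive A (λ v v∉A → positive-∸ (B-positive v v∉A)) A≠∅ A≠V
    where
    parking : IsPF G f
    parking = boxCondition⇒parking rep positive (boxCondition-cons F[0]≡1 (tail-condition-first-Q positive tail) tail)
    positive-∸ : ∀ {x y} → 1 ≤ x ∸ y → y < x
    positive-∸ {x} {y} 1≤x∸y = m∸n≢0⇒n<m (λ x∸y≡0 → case subst (1 ≤_) x∸y≡0 1≤x∸y of λ ())

  private
    module K₀ = OnK a q

  prime↔parking : Inverse (PPFinc (suc a) q) (PFinc a q)
  prime↔parking = mkInverseₛ to from (λ {f} {g} → to-cong {f} {g}) (λ {g} {g′} → from-cong {g} {g′}) to-from from-to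
    where
    open Setoid (PPFinc (suc a) q) using () renaming (Carrier to IncPPF; _≈_ to _≈₁_)
    open Setoid (PFinc a q) using () renaming (Carrier to IncPF; _≈_ to _≈₂_)

    to : IncPPF → IncPF
    to (f , ppf , inc) = f ∘ fs ,
      K₀.boxCondition⇒parking rep′ positive′ (prime⇒tail-condition rep ppf incN) ,
      K₀.IncreasingOn⇒increasing rep′ inc′
      where
      rep : Represents f (extendℕ f)
      rep = extendℕ-represents f
      incN : IncreasingOn (suc a) N (extendℕ f)
      incN = increasing⇒IncreasingOn rep inc
      rep′ : Represents (f ∘ fs) (extendℕ f ∘ suc)
      rep′ = represents (agrees rep ∘ fs)
      positive′ : Positive (a + q) (extendℕ f ∘ suc)
      positive′ k k< = parking⇒positive rep (proj₁ ppf) (suc k) (s≤s k<)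
      inc′ : IncreasingOn a (a + q) (extendℕ f ∘ suc)
      inc′ = (λ i j i≤j j<a → proj₁ incN (suc i) (suc j) (s≤s i≤j) (s≤s j<a)) ,
             (λ i j a≤i i≤j j< → proj₂ incN (suc i) (suc j) (s≤s a≤i) (s≤s i≤j) (s≤s j<))

    from : IncPF → IncPPF
    from (g , pf , inc) = 1 Vecᶠ.∷ g ,
      tail-condition⇒prime rep refl F-positive (K₀.parking⇒boxCondition grep pf incG) ,
      IncreasingOn⇒increasing rep (P-part , Q-part)
      where
      grep : Represents g (extendℕ g)
      grep = extendℕ-represents g
      incG : IncreasingOn a K₀.N (extendℕ g)
      incG = K₀.increasing⇒IncreasingOn grep inc
      F : ℕ → ℕ
      F = extendℕ (1 Vecᶠ.∷ g)
      rep : Represents (1 Vecᶠ.∷ g) F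
      rep = extendℕ-represents (1 Vecᶠ.∷ g)
      F-positive : Positive (suc a + q) F
      F-positive zero    _        = s≤s z≤n
      F-positive (suc k) (s≤s k<) = K₀.parking⇒positive grep pf k k<
      P-part : ∀ i j → i ≤ j → j < suc a → F i ≤ F j
      P-part zero    zero    _         _         = ≤-refl
      P-part zero    (suc j) _         (s≤s j<a) = F-positive (suc j) (s≤s (≤-trans j<a (m≤m+n a q)))
      P-part (suc i) (suc j) (s≤s i≤j) (s≤s j<a) = proj₁ incG i j i≤j j<a
      Q-part : ∀ i j → suc a ≤ i → i ≤ j → j < suc a + q → F i ≤ F j
      Q-part (suc i) (suc j) (s≤s a≤i) (s≤s i≤j) (s≤s j<) = proj₂ incG i j a≤i i≤j j<

    to-cong : ∀ {f f′} → f ≈₁ f′ → to f ≈₂ to f′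
    to-cong f≗f′ i = f≗f′ (fs i)

    from-cong : ∀ {g g′} → g ≈₂ g′ → from g ≈₁ from g′
    from-cong g≗g′ fz     = refl
    from-cong g≗g′ (fs i) = g≗g′ i

    to-from : ∀ g → to (from g) ≈₂ g
    to-from _ _ = refl

    from-to : ∀ f → from (to f) ≈₁ f
    from-to (f , ppf , inc) fz     =
      sym (prime⇒first-value rep ppf (increasing⇒IncreasingOn rep inc))
      where rep = extendℕ-represents f
    from-to (f , ppf , inc) (fs i) = refl

-- Counting

incSeqs : ℕ → ℕ → ℕ
incSeqs zero    u       = 1
incSeqs (suc r) zero    = 0
incSeqs (suc r) (suc u) = incSeqs (suc r) u + incSeqs r (suc u)

incSeqs-1 : ∀ r → incSeqs r 1 ≡ 1
incSeqs-1 zero    = refl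
incSeqs-1 (suc r) = incSeqs-1 r

incSeqs-length1 : ∀ u → incSeqs 1 u ≡ u
incSeqs-length1 zero    = refl
incSeqs-length1 (suc u) = trans (cong (_+ 1) (incSeqs-length1 u)) (+-comm u 1)

incSeqs-sym : ∀ r s → incSeqs r (suc s) ≡ incSeqs s (suc r)
incSeqs-sym zero    zero    = refl
incSeqs-sym zero    (suc s) = sym (incSeqs-1 (suc s))
incSeqs-sym (suc r) zero    = incSeqs-1 (suc r)
incSeqs-sym (suc r) (suc s) = begin
  incSeqs (suc r) (suc s) + incSeqs r (suc (suc s))
    ≡⟨ cong₂ _+_ (incSeqs-sym (suc r) s) (incSeqs-sym r (suc s)) ⟩
  incSeqs s (suc (suc r)) + incSeqs (suc s) (suc r)
    ≡⟨ +-comm (incSeqs s (suc (suc r))) _ ⟩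
  incSeqs (suc s) (suc r) + incSeqs s (suc (suc r)) ∎
  where open ≡-Reasoning

incSeqs≡C : ∀ r s → incSeqs r (suc s) ≡ (r + s) C r
incSeqs≡C zero    s = refl
incSeqs≡C (suc r) zero rewrite +-identityʳ r = trans (incSeqs-1 (suc r)) (sym (nCn≡1 (suc r)))
incSeqs≡C (suc r) (suc s) = begin
  incSeqs (suc r) (suc s) + incSeqs r (suc (suc s))
    ≡⟨ cong₂ _+_ (incSeqs≡C (suc r) s) (incSeqs≡C r (suc s)) ⟩
  (suc r + s) C suc r + (r + suc s) C r
    ≡⟨ cong (λ n → n C suc r + (r + suc s) C r) (sym (+-suc r s)) ⟩
  (r + suc s) C suc r + (r + suc s) C r
    ≡⟨ +-comm ((r + suc s) C suc r) _ ⟩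
  (r + suc s) C r + (r + suc s) C suc r
    ≡⟨ nCk+nC[k+1]≡[n+1]C[k+1] (r + suc s) r ⟩
  suc (r + suc s) C suc r ∎
  where open ≡-Reasoning

incSeqs-absorb : ∀ r s → suc r * incSeqs (suc r) (suc s) ≡ (suc r + s) * incSeqs r (suc s)
incSeqs-absorb r zero = begin
  suc r * incSeqs (suc r) 1 ≡⟨ cong (suc r *_) (incSeqs-1 (suc r)) ⟩
  suc r * 1                 ≡⟨ cong₂ _*_ (sym (+-identityʳ (suc r))) (sym (incSeqs-1 r)) ⟩
  (suc r + 0) * incSeqs r 1 ∎
  where open ≡-Reasoning
incSeqs-absorb zero (suc s) = begin
  1 * incSeqs 1 (suc (suc s)) ≡⟨ *-identityˡ _ ⟩
  incSeqs 1 (suc (suc s))     ≡⟨ incSeqs-length1 (suc (suc s)) ⟩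
  suc (suc s)                 ≡⟨ sym (*-identityʳ _) ⟩
  suc (suc s) * 1             ∎
  where open ≡-Reasoning
incSeqs-absorb (suc r) (suc s) = begin
  suc (suc r) * (X + Y)
    ≡⟨ *-distribˡ-+ (suc (suc r)) X Y ⟩
  suc (suc r) * X + suc (suc r) * Y
    ≡⟨ cong₂ (λ u v → u + (Y + v)) (incSeqs-absorb (suc r) s) (incSeqs-absorb r (suc s)) ⟩
  (suc (suc r) + s) * P + ((P + Q) + (suc r + suc s) * Q)
    ≡⟨ solve 4 (λ r s P Q → (con 2 :+ r :+ s) :* P :+ ((P :+ Q) :+ (con 1 :+ r :+ (con 1 :+ s)) :* Q)
                           := (con 2 :+ r :+ (con 1 :+ s)) :* (P :+ Q)) refl r s P Q ⟩
  (suc (suc r) + suc s) * (P + Q) ∎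
  where
  open ≡-Reasoning
  X Y P Q : ℕ
  X = incSeqs (suc (suc r)) (suc s)
  Y = incSeqs (suc r) (suc (suc s))
  P = incSeqs (suc r) (suc s)
  Q = incSeqs r (suc (suc s))

-- The size of LinkedPairs a u (d + u) b (see enumerate below); the length of y is written d + u
-- because the recursion never needs y to be shorter than the bound u of x.
linkedCount : ℕ → ℕ → ℕ → ℕ → ℕ
linkedCount a u d zero = incSeqs a 0 * incSeqs (d + u) 0
linkedCount a u (suc d) (suc b) = linkedCount a u d (suc b) + linkedCount a u (suc d) b
linkedCount a zero zero (suc b) = incSeqs a 0
linkedCount a (suc u) zero (suc b) with b ≟ a
... | yes _ = linkedCount a u zero (suc b) + linkedCount a (suc u) zero b
linkedCount zero (suc u) zero (suc b) | no _ = 0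
linkedCount (suc a) (suc u) zero (suc b) | no _ =
  linkedCount (suc a) u 1 (suc b) + linkedCount a (suc u) zero (suc b)

linkedCount-unbounded : ∀ a d b → linkedCount a 0 d b ≡ incSeqs a 0 * incSeqs d b
linkedCount-unbounded a d zero = cong (λ l → incSeqs a 0 * incSeqs l 0) (+-identityʳ d)
linkedCount-unbounded a (suc d) (suc b) = begin
  linkedCount a 0 d (suc b) + linkedCount a 0 (suc d) b
    ≡⟨ cong₂ _+_ (linkedCount-unbounded a d (suc b)) (linkedCount-unbounded a (suc d) b) ⟩
  incSeqs a 0 * incSeqs d (suc b) + incSeqs a 0 * incSeqs (suc d) b
    ≡⟨ sym (*-distribˡ-+ (incSeqs a 0) _ _) ⟩
  incSeqs a 0 * (incSeqs d (suc b) + incSeqs (suc d) b)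
    ≡⟨ cong (incSeqs a 0 *_) (+-comm (incSeqs d (suc b)) _) ⟩
  incSeqs a 0 * incSeqs (suc d) (suc b) ∎
  where open ≡-Reasoning
linkedCount-unbounded a zero (suc b) = sym (*-identityʳ (incSeqs a 0))

linkedCount-0-1 : ∀ u → linkedCount 0 u 0 1 ≡ 1
linkedCount-0-1 zero    = refl
linkedCount-0-1 (suc u) = trans (+-identityʳ _) (linkedCount-0-1 u)

incSeqs-pascal-pred : ∀ l b → 1 ≤ l → incSeqs (suc l) b ≡ incSeqs (suc l) (b ∸ 1) + incSeqs l b
incSeqs-pascal-pred (suc l) zero    _ = refl
incSeqs-pascal-pred l       (suc b) _ = refl

-- Of the incSeqs a u * incSeqs l b pairs (x, y), exactly incSeqs (suc a) u * incSeqs l (b ∸ 1)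
-- are not linked.
linkedCount-complement : ∀ a u d b → b ≤ suc a →
  linkedCount a u d b + incSeqs (suc a) u * incSeqs (d + u) (b ∸ 1) ≡ incSeqs a u * incSeqs (d + u) b
linkedCount-complement a zero d b _ = begin
  linkedCount a 0 d b + 0           ≡⟨ +-identityʳ _ ⟩
  linkedCount a 0 d b               ≡⟨ linkedCount-unbounded a d b ⟩
  incSeqs a 0 * incSeqs d b         ≡⟨ cong (λ l → incSeqs a 0 * incSeqs l b) (sym (+-identityʳ d)) ⟩
  incSeqs a 0 * incSeqs (d + 0) b   ∎
  where open ≡-Reasoning
linkedCount-complement a (suc u) d zero _
  rewrite +-suc d u | *-zeroʳ (incSeqs a 0) | *-zeroʳ (incSeqs (suc a) (suc u)) | *-zeroʳ (incSeqs a (suc u)) = refl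
linkedCount-complement a (suc u) (suc d) (suc b) b≤ = begin
  (c₁ + c₂) + M * incSeqs (suc L) b
    ≡⟨ cong (λ z → (c₁ + c₂) + M * z) (incSeqs-pascal-pred L b (≤-trans (s≤s z≤n) (m≤n+m (suc u) d))) ⟩
  (c₁ + c₂) + M * (incSeqs (suc L) (b ∸ 1) + incSeqs L b)
    ≡⟨ solve 5 (λ c₁ c₂ M Y X → (c₁ :+ c₂) :+ M :* (Y :+ X) := (c₂ :+ M :* Y) :+ (c₁ :+ M :* X))
               refl c₁ c₂ M (incSeqs (suc L) (b ∸ 1)) (incSeqs L b) ⟩
  (c₂ + M * incSeqs (suc L) (b ∸ 1)) + (c₁ + M * incSeqs L b)
    ≡⟨ cong₂ _+_ (linkedCount-complement a (suc u) (suc d) b (≤-trans (n≤1+n b) b≤))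
                 (linkedCount-complement a (suc u) d (suc b) b≤) ⟩
  A * incSeqs (suc L) b + A * incSeqs L (suc b)
    ≡⟨ sym (*-distribˡ-+ A _ _) ⟩
  A * incSeqs (suc L) (suc b) ∎
  where
  open ≡-Reasoning
  L c₁ c₂ M A : ℕ
  L  = d + suc u
  c₁ = linkedCount a (suc u) d (suc b)
  c₂ = linkedCount a (suc u) (suc d) b
  M  = incSeqs (suc a) (suc u)
  A  = incSeqs a (suc u)
linkedCount-complement a (suc u) zero (suc b) b≤ with b ≟ a
linkedCount-complement zero (suc u) zero (suc .zero) _ | yes refl
  rewrite linkedCount-0-1 u | *-zeroʳ (incSeqs 1 (suc u)) | incSeqs-1 u = refl
linkedCount-complement (suc a) (suc u) zero (suc .(suc a)) b≤ | yes refl = begin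
  (c₁ + c₂) + (M′ + A) * (Bp + Bq)
    ≡⟨ solve 6 (λ c₁ c₂ M′ A Bp Bq → (c₁ :+ c₂) :+ (M′ :+ A) :* (Bp :+ Bq)
                := (c₂ :+ (M′ :+ A) :* Bp) :+ (c₁ :+ M′ :* Bq) :+ A :* Bq) refl c₁ c₂ M′ A Bp Bq ⟩
  (c₂ + (M′ + A) * Bp) + (c₁ + M′ * Bq) + A * Bq
    ≡⟨ cong₂ (λ x y → x + y + A * Bq)
             (linkedCount-complement (suc a) (suc u) zero (suc a) (n≤1+n _))
             (linkedCount-complement (suc a) u zero (suc (suc a)) b≤) ⟩
  A * (Bp + Bq) + A₁ * Bs + A * Bq
    ≡⟨ cong (λ z → A * (Bp + Bq) + A₁ * Bs + z) (sym cross) ⟩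
  A * (Bp + Bq) + A₁ * Bs + A₂ * Bs
    ≡⟨ solve 5 (λ A₁ A₂ Bp Bq Bs → (A₁ :+ A₂) :* (Bp :+ Bq) :+ A₁ :* Bs :+ A₂ :* Bs
                := (A₁ :+ A₂) :* ((Bp :+ Bq) :+ Bs)) refl A₁ A₂ Bp Bq Bs ⟩
  A * ((Bp + Bq) + Bs) ∎
  where
  open ≡-Reasoning
  c₁ c₂ M′ A₁ A₂ A Bp Bq Bs : ℕ
  c₁ = linkedCount (suc a) u zero (suc (suc a))
  c₂ = linkedCount (suc a) (suc u) zero (suc a)
  M′ = incSeqs (suc (suc a)) u
  A₁ = incSeqs (suc a) u
  A₂ = incSeqs a (suc u)
  A  = incSeqs (suc a) (suc u)
  Bp = incSeqs (suc u) a
  Bq = incSeqs u (suc a)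
  Bs = incSeqs u (suc (suc a))
  cross : A₂ * Bs ≡ A * Bq
  cross = begin
    A₂ * Bs                               ≡⟨ cong₂ _*_ (incSeqs-sym a u) (incSeqs-sym u (suc a)) ⟩
    incSeqs u (suc a) * A                 ≡⟨ *-comm (incSeqs u (suc a)) A ⟩
    A * Bq                                ∎
linkedCount-complement zero (suc u) zero (suc b) b≤ | no b≢a = ⊥-elim (b≢a (n≤0⇒n≡0 (s≤s⁻¹ b≤)))
linkedCount-complement (suc a) (suc u) zero (suc b) b≤ | no b≢a = begin
  (c₁ + c₂) + (M′ + (A₁ + A₂)) * Y
    ≡⟨ solve 7 (λ c₁ c₂ M′ A₁ A₂ Y Z → (c₁ :+ c₂) :+ (M′ :+ (A₁ :+ A₂)) :* Y
                := (c₁ :+ M′ :* Y) :+ (c₂ :+ (A₁ :+ A₂) :* Y)) refl c₁ c₂ M′ A₁ A₂ Y 0 ⟩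
  (c₁ + M′ * Y) + (c₂ + (A₁ + A₂) * Y)
    ≡⟨ cong₂ _+_ (linkedCount-complement (suc a) u 1 (suc b) b≤)
                 (linkedCount-complement a (suc u) zero (suc b) (≤∧≢⇒< (s≤s⁻¹ b≤) b≢a)) ⟩
  A₁ * Z + A₂ * Z
    ≡⟨ sym (*-distribʳ-+ Z A₁ A₂) ⟩
  (A₁ + A₂) * Z ∎
  where
  open ≡-Reasoning
  c₁ c₂ M′ A₁ A₂ Y Z : ℕ
  c₁ = linkedCount (suc a) u 1 (suc b)
  c₂ = linkedCount a (suc u) zero (suc b)
  M′ = incSeqs (suc (suc a)) u
  A₁ = incSeqs (suc a) u
  A₂ = incSeqs a (suc u)
  Y  = incSeqs (suc u) b
  Z  = incSeqs (suc u) (suc b)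

incSeqs-absorb′ : ∀ a q → (a + suc q) * incSeqs (suc q) a ≡ a * incSeqs (suc q) (suc a)
incSeqs-absorb′ zero    q = *-zeroʳ q
incSeqs-absorb′ (suc a) q = begin
  (suc a + suc q) * incSeqs (suc q) (suc a) ≡⟨ cong ((suc a + suc q) *_) (incSeqs-sym (suc q) a) ⟩
  (suc a + suc q) * incSeqs a (suc (suc q)) ≡⟨ sym (incSeqs-absorb a (suc q)) ⟩
  suc a * incSeqs (suc a) (suc (suc q))     ≡⟨ cong (suc a *_) (incSeqs-sym (suc a) (suc q)) ⟩
  suc a * incSeqs (suc q) (suc (suc a))     ∎
  where open ≡-Reasoning

linkedCount-closedForm : ∀ a q → (a + suc q) * linkedCount a (suc q) 0 (suc a)
                                  ≡ ((a + suc q) C suc a) * ((a + suc q) C a)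
linkedCount-closedForm a q = begin
  m * c   ≡⟨ *-cancelˡ-≡ (m * c) (c₁ * c₀) (suc a) (+-cancelʳ-≡ (a * (suc q * c₀ * c₀)) _ _ scaled) ⟩
  c₁ * c₀ ≡⟨ cong₂ _*_ c₁≡C c₀≡C ⟩
  (m C suc a) * (m C a) ∎
  where
  open ≡-Reasoning
  m c c₀ c₁ A E : ℕ
  m  = a + suc q
  c  = linkedCount a (suc q) 0 (suc a)
  c₀ = incSeqs (suc q) (suc a)
  c₁ = incSeqs (suc a) (suc q)
  A  = incSeqs a (suc q)
  E  = incSeqs (suc q) a
  complement : c + c₁ * E ≡ A * c₀
  complement = linkedCount-complement a (suc q) 0 (suc a) ≤-refl
  mA : m * A ≡ suc q * c₀
  mA = trans (cong₂ _*_ (+-comm a (suc q)) (incSeqs-sym a q)) (sym (incSeqs-absorb q a))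
  mE : m * E ≡ a * c₀
  mE = incSeqs-absorb′ a q
  c₁-absorb : suc a * c₁ ≡ suc q * c₀
  c₁-absorb = trans (incSeqs-absorb a q) (trans (cong (_* A) (sym (+-suc a q))) mA)
  -- both sides are multiplied by  suc a  and shifted by  a q c₀²  so that no subtraction occurs
  scaled : suc a * (m * c) + a * (suc q * c₀ * c₀) ≡ suc a * (c₁ * c₀) + a * (suc q * c₀ * c₀)
  scaled = begin
    suc a * (m * c) + a * (suc q * c₀ * c₀)
      ≡⟨ cong (λ z → suc a * (m * c) + a * (z * c₀)) (sym c₁-absorb) ⟩
    suc a * (m * c) + a * (suc a * c₁ * c₀)
      ≡⟨ solve 5 (λ a m c c₁ c₀ → (con 1 :+ a) :* (m :* c) :+ a :* ((con 1 :+ a) :* c₁ :* c₀)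
                                := (con 1 :+ a) :* (m :* c :+ c₁ :* (a :* c₀))) refl a m c c₁ c₀ ⟩
    suc a * (m * c + c₁ * (a * c₀))
      ≡⟨ cong (λ z → suc a * (m * c + c₁ * z)) (sym mE) ⟩
    suc a * (m * c + c₁ * (m * E))
      ≡⟨ cong (suc a *_) (solve 4 (λ m c c₁ E → m :* c :+ c₁ :* (m :* E) := m :* (c :+ c₁ :* E)) refl m c c₁ E) ⟩
    suc a * (m * (c + c₁ * E))
      ≡⟨ cong (λ z → suc a * (m * z)) complement ⟩
    suc a * (m * (A * c₀))
      ≡⟨ cong (suc a *_) (trans (sym (*-assoc m A c₀)) (cong (_* c₀) mA)) ⟩
    suc a * (suc q * c₀ * c₀)
      ≡⟨ solve 2 (λ a x → (con 1 :+ a) :* x := x :+ a :* x) refl a (suc q * c₀ * c₀) ⟩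
    suc q * c₀ * c₀ + a * (suc q * c₀ * c₀)
      ≡⟨ cong (λ z → z * c₀ + a * (suc q * c₀ * c₀)) (sym c₁-absorb) ⟩
    suc a * c₁ * c₀ + a * (suc q * c₀ * c₀)
      ≡⟨ cong (_+ a * (suc q * c₀ * c₀)) (*-assoc (suc a) c₁ c₀) ⟩
    suc a * (c₁ * c₀) + a * (suc q * c₀ * c₀) ∎
  c₁≡C : c₁ ≡ m C suc a
  c₁≡C = trans (incSeqs≡C (suc a) q) (cong (_C suc a) (sym (+-suc a q)))
  c₀≡C : c₀ ≡ m C a
  c₀≡C = trans (incSeqs-sym (suc q) a) (incSeqs≡C a (suc q))

-- Linked pairs of increasing sequences

Enumeration : Setoid 0ℓ 0ℓ → ℕ → Set
Enumeration S n = Inverse S (≡.setoid (Fin n))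

enumeration-⊎ : ∀ {S S₁ S₂ m n} → Inverse S (S₁ ⊎ₛ S₂) → Enumeration S₁ m → Enumeration S₂ n →
                Enumeration S (m + n)
enumeration-⊎ {m = m} {n} split e₁ e₂ =
  Compose.inverse split
    (Compose.inverse (e₁ ⊎-inverse e₂)
      (Compose.inverse (Pointwise-≡↔≡ (Fin m) (Fin n)) (Symmetry.inverse (+↔⊎ {m} {n}))))

enumeration-empty : ∀ {S} → (Setoid.Carrier S → ⊥) → Enumeration S 0
enumeration-empty empty =
  mkInverseₛ (λ x → ⊥-elim (empty x)) (λ ()) (λ {x} _ → ⊥-elim (empty x)) (λ { {()} }) (λ ())
             (λ x → ⊥-elim (empty x))

enumeration-singleton : ∀ {S} (c : Setoid.Carrier S) → (∀ x → Setoid._≈_ S x c) → Enumeration S 1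
enumeration-singleton {S} c unique =
  mkInverseₛ (λ _ → fz) (λ _ → c) (λ _ → refl) (λ _ → Setoid.refl S) (λ { fz → refl })
             (λ x → Setoid.sym S (unique x))

AgreeBelow : ℕ → (ℕ → ℕ) → (ℕ → ℕ) → Set
AgreeBelow n s t = ∀ i → i < n → s i ≡ t i

record IncSeq (len bound : ℕ) (s : ℕ → ℕ) : Set where
  field
    positive : ∀ i → i < len → 1 ≤ s i
    bounded  : ∀ i → i < len → s i ≤ bound
    monotone : ∀ i j → i ≤ j → j < len → s i ≤ s j
open IncSeq

IncSeq-init : ∀ {len b s} → IncSeq (suc len) b s → IncSeq len b s
IncSeq-init inc = record
  { positive = λ i i< → positive inc i (m<n⇒m<1+n i<)
  ; bounded  = λ i i< → bounded inc i (m<n⇒m<1+n i<)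
  ; monotone = λ i j i≤j j< → monotone inc i j i≤j (m<n⇒m<1+n j<)
  }

IncSeq-rebound : ∀ {len b b′ s} → IncSeq len b s → (∀ i → i < len → s i ≤ b′) → IncSeq len b′ s
IncSeq-rebound inc bounded′ = record
  { positive = positive inc
  ; bounded  = bounded′
  ; monotone = monotone inc
  }

IncSeq-weaken : ∀ {len b b′ s} → b ≤ b′ → IncSeq len b s → IncSeq len b′ s
IncSeq-weaken b≤b′ inc = IncSeq-rebound inc (λ i i< → ≤-trans (bounded inc i i<) b≤b′)

IncSeq-lower : ∀ {len b s} → IncSeq (suc len) (suc b) s → s len ≢ suc b → IncSeq (suc len) b s
IncSeq-lower {len} inc last≢b = IncSeq-rebound inc λ i i< →
  s≤s⁻¹ (≤-trans (s≤s (monotone inc i len (s≤s⁻¹ i<) ≤-refl)) (≤∧≢⇒< (bounded inc len ≤-refl) last≢b))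

IncSeq-inhabited-bound : ∀ {len s} → IncSeq (suc len) 0 s → ⊥
IncSeq-inhabited-bound inc with ≤-trans (positive inc 0 z<s) (bounded inc 0 z<s)
... | ()

snoc : (ℕ → ℕ) → ℕ → ℕ → ℕ → ℕ
snoc s n v i with i <? n
... | yes _ = s i
... | no  _ = v

snoc-< : ∀ s n v i → i < n → snoc s n v i ≡ s i
snoc-< s n v i i<n with i <? n
... | yes _   = refl
... | no  i≮n = ⊥-elim (i≮n i<n)

snoc-last : ∀ s n v → snoc s n v n ≡ v
snoc-last s n v with n <? n
... | yes n<n = ⊥-elim (<-irrefl refl n<n)
... | no  _   = refl

snoc-agree : ∀ {s n v} → s n ≡ v → AgreeBelow (suc n) (snoc s n v) s
snoc-agree {s} {n} {v} sn≡v i i< with m<1+n⇒m<n∨m≡n i<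
... | inj₁ i<n  = snoc-< s n v i i<n
... | inj₂ refl = trans (snoc-last s n v) (sym sn≡v)

snoc-cong : ∀ {s t} n v → AgreeBelow n s t → AgreeBelow (suc n) (snoc s n v) (snoc t n v)
snoc-cong {s} {t} n v s≗t i i< with m<1+n⇒m<n∨m≡n i<
... | inj₁ i<n  = trans (snoc-< s n v i i<n) (trans (s≗t i i<n) (sym (snoc-< t n v i i<n)))
... | inj₂ refl = trans (snoc-last s n v) (sym (snoc-last t n v))

IncSeq-snoc : ∀ {len b s} → IncSeq len (suc b) s → IncSeq (suc len) (suc b) (snoc s len (suc b))
IncSeq-snoc {len} {b} {s} inc = record
  { positive = λ i i< → case< {1 ≤_} i i< (positive inc i) (s≤s z≤n)
  ; bounded  = λ i i< → case< {_≤ suc b} i i< (bounded inc i) ≤-refl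
  ; monotone = mono
  }
  where
  case< : ∀ {P : ℕ → Set} i → i < suc len → (i < len → P (s i)) → P (suc b) → P (snoc s len (suc b) i)
  case< {P} i i< below last with m<1+n⇒m<n∨m≡n i<
  ... | inj₁ i<len = subst P (sym (snoc-< s len _ i i<len)) (below i<len)
  ... | inj₂ refl  = subst P (sym (snoc-last s len _)) last
  mono : ∀ i j → i ≤ j → j < suc len → snoc s len (suc b) i ≤ snoc s len (suc b) j
  mono i j i≤j j< with m<1+n⇒m<n∨m≡n j<
  ... | inj₁ j<len rewrite snoc-< s len (suc b) j j<len | snoc-< s len (suc b) i (≤-<-trans i≤j j<len) =
    monotone inc i j i≤j j<len
  ... | inj₂ refl rewrite snoc-last s len (suc b) = case< {_≤ suc b} i (s≤s i≤j) (bounded inc i) ≤-refl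

record LinkedPair (a u l b : ℕ) : Set where
  constructor linked
  field
    x     : ℕ → ℕ
    y     : ℕ → ℕ
    x-inc : IncSeq a u x
    y-inc : IncSeq l b y
    link  : ∀ k → k < a → y (x k ∸ 1) ≤ suc k
open LinkedPair

LinkedPairs : ℕ → ℕ → ℕ → ℕ → Setoid 0ℓ 0ℓ
LinkedPairs a u l b = record
  { Carrier       = LinkedPair a u l b
  ; _≈_           = λ p p′ → AgreeBelow a (x p) (x p′) × AgreeBelow l (y p) (y p′)
  ; isEquivalence = record
    { refl  = (λ _ _ → refl) , (λ _ _ → refl)
    ; sym   = λ (ex , ey) → (λ i i< → sym (ex i i<)) , (λ j j< → sym (ey j j<))
    ; trans = λ (ex , ey) (ex′ , ey′) → (λ i i< → trans (ex i i<) (ex′ i i<))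
                                      , (λ j j< → trans (ey j j<) (ey′ j j<))
    }
  }

pred<-of-bounded : ∀ {v w} → 1 ≤ v → v ≤ w → v ∸ 1 < w
pred<-of-bounded {suc v} {suc w} _ (s≤s v≤w) = s≤s v≤w

module LastY (a u u′ l b : ℕ) (u′≤l : u′ ≤ l) (u′≤u : u′ ≤ u)
  (x-bounded-if-top : ∀ (p : LinkedPair a u (suc l) (suc b)) → y p l ≡ suc b → ∀ k → k < a → x p k ≤ u′)
  where

  to : LinkedPair a u (suc l) (suc b) → LinkedPair a u′ l (suc b) ⊎ LinkedPair a u (suc l) b
  to p@(linked x y x-inc y-inc link) with y l ≟ suc b
  ... | yes top = inj₁ (linked x y (IncSeq-rebound x-inc (x-bounded-if-top p top)) (IncSeq-init y-inc) link)
  ... | no ¬top = inj₂ (linked x y x-inc (IncSeq-lower y-inc ¬top) link)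

  from₁ : LinkedPair a u′ l (suc b) → LinkedPair a u (suc l) (suc b)
  from₁ (linked x y x-inc y-inc link) =
    linked x (snoc y l (suc b)) (IncSeq-weaken u′≤u x-inc) (IncSeq-snoc y-inc) link′
    where
    link′ : ∀ k → k < a → snoc y l (suc b) (x k ∸ 1) ≤ suc k
    link′ k k<a = subst (_≤ suc k) (sym (snoc-< y l (suc b) _ x[k]-1<l)) (link k k<a)
      where
      x[k]-1<l : x k ∸ 1 < l
      x[k]-1<l = ≤-trans (pred<-of-bounded (positive x-inc k k<a) (bounded x-inc k k<a)) u′≤l

  from₂ : LinkedPair a u (suc l) b → LinkedPair a u (suc l) (suc b)
  from₂ (linked x y x-inc y-inc link) = linked x y x-inc (IncSeq-weaken (n≤1+n b) y-inc) link

  private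
    module S = Setoid (LinkedPairs a u (suc l) (suc b))
    module T = Setoid (LinkedPairs a u′ l (suc b) ⊎ₛ LinkedPairs a u (suc l) b)

  from : LinkedPair a u′ l (suc b) ⊎ LinkedPair a u (suc l) b → LinkedPair a u (suc l) (suc b)
  from = [ from₁ , from₂ ]′

  to-cong : ∀ {p p′} → p S.≈ p′ → to p T.≈ to p′
  to-cong {p} {p′} (ex , ey) with y p l ≟ suc b | y p′ l ≟ suc b
  ... | yes _   | yes _    = Pointwise.inj₁ (ex , λ j j< → ey j (m<n⇒m<1+n j<))
  ... | yes top | no ¬top′ = ⊥-elim (¬top′ (trans (sym (ey l ≤-refl)) top))
  ... | no ¬top | yes top′ = ⊥-elim (¬top (trans (ey l ≤-refl) top′))
  ... | no _    | no _     = Pointwise.inj₂ (ex , ey)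

  from-cong : ∀ {q q′} → q T.≈ q′ → from q S.≈ from q′
  from-cong (Pointwise.inj₁ (ex , ey)) = ex , snoc-cong l (suc b) ey
  from-cong (Pointwise.inj₂ eq)        = eq

  to-from : ∀ q → to (from q) T.≈ q
  to-from (inj₁ (linked x y _ y-inc _)) with snoc y l (suc b) l ≟ suc b
  ... | yes _   = Pointwise.inj₁ ((λ _ _ → refl) , λ j j< → snoc-< y l (suc b) j j<)
  ... | no ¬top = ⊥-elim (¬top (snoc-last y l (suc b)))
  to-from (inj₂ (linked x y _ y-inc _)) with y l ≟ suc b
  ... | yes top = ⊥-elim (<-irrefl refl (subst (_≤ b) top (bounded y-inc l ≤-refl)))
  ... | no _    = Pointwise.inj₂ ((λ _ _ → refl) , (λ _ _ → refl))

  from-to : ∀ p → from (to p) S.≈ p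
  from-to (linked x y _ _ _) with y l ≟ suc b
  ... | yes top = (λ _ _ → refl) , snoc-agree top
  ... | no _    = (λ _ _ → refl) , (λ _ _ → refl)

  split : Inverse (LinkedPairs a u (suc l) (suc b)) (LinkedPairs a u′ l (suc b) ⊎ₛ LinkedPairs a u (suc l) b)
  split = mkInverseₛ to from to-cong from-cong to-from from-to

module LastX (a u l b : ℕ) (u<l : u < l) (b≤1+a : b ≤ suc a) where

  to : LinkedPair (suc a) (suc u) l b → LinkedPair (suc a) u l b ⊎ LinkedPair a (suc u) l b
  to (linked x y x-inc y-inc link) with x a ≟ suc u
  ... | yes _   = inj₂ (linked x y (IncSeq-init x-inc) y-inc (λ k k< → link k (m<n⇒m<1+n k<)))
  ... | no ¬top = inj₁ (linked x y (IncSeq-lower x-inc ¬top) y-inc link)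

  from₁ : LinkedPair (suc a) u l b → LinkedPair (suc a) (suc u) l b
  from₁ (linked x y x-inc y-inc link) = linked x y (IncSeq-weaken (n≤1+n u) x-inc) y-inc link

  from₂ : LinkedPair a (suc u) l b → LinkedPair (suc a) (suc u) l b
  from₂ (linked x y x-inc y-inc link) = linked (snoc x a (suc u)) y (IncSeq-snoc x-inc) y-inc link′
    where
    link′ : ∀ k → k < suc a → y (snoc x a (suc u) k ∸ 1) ≤ suc k
    link′ k k< with m<1+n⇒m<n∨m≡n k<
    ... | inj₁ k<a  rewrite snoc-< x a (suc u) k k<a = link k k<a
    ... | inj₂ refl rewrite snoc-last x a (suc u) = ≤-trans (bounded y-inc u u<l) b≤1+a

  private
    module S = Setoid (LinkedPairs (suc a) (suc u) l b)
    module T = Setoid (LinkedPairs (suc a) u l b ⊎ₛ LinkedPairs a (suc u) l b)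

  from : LinkedPair (suc a) u l b ⊎ LinkedPair a (suc u) l b → LinkedPair (suc a) (suc u) l b
  from = [ from₁ , from₂ ]′

  to-cong : ∀ {p p′} → p S.≈ p′ → to p T.≈ to p′
  to-cong {p} {p′} (ex , ey) with x p a ≟ suc u | x p′ a ≟ suc u
  ... | yes _   | yes _    = Pointwise.inj₂ ((λ i i< → ex i (m<n⇒m<1+n i<)) , ey)
  ... | yes top | no ¬top′ = ⊥-elim (¬top′ (trans (sym (ex a ≤-refl)) top))
  ... | no ¬top | yes top′ = ⊥-elim (¬top (trans (ex a ≤-refl) top′))
  ... | no _    | no _     = Pointwise.inj₁ (ex , ey)

  from-cong : ∀ {q q′} → q T.≈ q′ → from q S.≈ from q′
  from-cong (Pointwise.inj₁ eq)        = eq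
  from-cong (Pointwise.inj₂ (ex , ey)) = snoc-cong a (suc u) ex , ey

  to-from : ∀ q → to (from q) T.≈ q
  to-from (inj₁ (linked x y x-inc _ _)) with x a ≟ suc u
  ... | yes top = ⊥-elim (<-irrefl refl (subst (_≤ u) top (bounded x-inc a ≤-refl)))
  ... | no _    = Pointwise.inj₁ ((λ _ _ → refl) , (λ _ _ → refl))
  to-from (inj₂ (linked x y _ _ _)) with snoc x a (suc u) a ≟ suc u
  ... | yes _   = Pointwise.inj₂ ((λ i i< → snoc-< x a (suc u) i i<) , (λ _ _ → refl))
  ... | no ¬top = ⊥-elim (¬top (snoc-last x a (suc u)))

  from-to : ∀ p → from (to p) S.≈ p
  from-to (linked x y _ _ _) with x a ≟ suc u
  ... | yes top = snoc-agree top , (λ _ _ → refl)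
  ... | no _    = (λ _ _ → refl) , (λ _ _ → refl)

  split : Inverse (LinkedPairs (suc a) (suc u) l b) (LinkedPairs (suc a) u l b ⊎ₛ LinkedPairs a (suc u) l b)
  split = mkInverseₛ to from to-cong from-cong to-from from-to

nilPair : ∀ {u b} → LinkedPair 0 u 0 b
nilPair = linked (λ _ → 0) (λ _ → 0) empty empty (λ _ ())
  where
  empty : ∀ {b} → IncSeq 0 b (λ _ → 0)
  empty = record { positive = λ _ () ; bounded = λ _ () ; monotone = λ _ _ _ () }

nilPair-unique : ∀ {u b} (p : LinkedPair 0 u 0 b) → Setoid._≈_ (LinkedPairs 0 u 0 b) p nilPair
nilPair-unique _ = (λ _ ()) , (λ _ ())

enumerate-y-empty-range : ∀ a u l → u ≤ l → Enumeration (LinkedPairs a u l 0) (incSeqs a 0 * incSeqs l 0)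
enumerate-y-empty-range zero    u       zero    _ = enumeration-singleton nilPair nilPair-unique
enumerate-y-empty-range (suc a) zero    zero    _ = enumeration-empty (IncSeq-inhabited-bound ∘ x-inc)
enumerate-y-empty-range a       u       (suc l) _ =
  subst (Enumeration _) (sym (*-zeroʳ (incSeqs a 0))) (enumeration-empty (IncSeq-inhabited-bound ∘ y-inc))

enumerate-x-empty-range : ∀ a b → Enumeration (LinkedPairs a 0 0 (suc b)) (incSeqs a 0)
enumerate-x-empty-range zero    b = enumeration-singleton nilPair nilPair-unique
enumerate-x-empty-range (suc a) b = enumeration-empty (IncSeq-inhabited-bound ∘ x-inc)

x-bounded-if-y-top : ∀ a u (p : LinkedPair a (suc u) (suc u) (suc a)) →
                     y p u ≡ suc a → ∀ k → k < a → x p k ≤ u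
x-bounded-if-y-top a u (linked x y x-inc _ link) top k k<a with x k ≟ suc u
... | no  x[k]≢top = s≤s⁻¹ (≤∧≢⇒< (bounded x-inc k k<a) x[k]≢top)
... | yes x[k]≡top = ⊥-elim (<-irrefl refl (≤-<-trans (s≤s⁻¹ y[u]≤1+k) k<a))
  where
  y[u]≤1+k : suc a ≤ suc k
  y[u]≤1+k = subst (_≤ suc k) top (subst (λ v → y (v ∸ 1) ≤ suc k) x[k]≡top (link k k<a))

enumerate : ∀ a u d b → b ≤ suc a → Enumeration (LinkedPairs a u (d + u) b) (linkedCount a u d b)
enumerate a u d zero _ = enumerate-y-empty-range a u (d + u) (m≤n+m u d)
enumerate a u (suc d) (suc b) b≤ =
  enumeration-⊎ (LastY.split a u u (d + u) b (m≤n+m u d) ≤-refl (λ p _ → bounded (x-inc p)))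
                (enumerate a u d (suc b) b≤) (enumerate a u (suc d) b (≤-trans (n≤1+n b) b≤))
enumerate a zero zero (suc b) _ = enumerate-x-empty-range a b
enumerate a (suc u) zero (suc b) b≤ with b ≟ a
enumerate a (suc u) zero (suc .a) b≤ | yes refl =
  enumeration-⊎ (LastY.split a (suc u) u u a ≤-refl (n≤1+n u) (x-bounded-if-y-top a u))
                (enumerate a u zero (suc a) b≤) (enumerate a (suc u) zero a (n≤1+n a))
enumerate zero (suc u) zero (suc b) b≤ | no b≢a = ⊥-elim (b≢a (n≤0⇒n≡0 (s≤s⁻¹ b≤)))
enumerate (suc a) (suc u) zero (suc b) b≤ | no b≢a =
  enumeration-⊎ (LastX.split a u (suc u) (suc b) ≤-refl b<1+a)
                (enumerate (suc a) u 1 (suc b) b≤) (enumerate a (suc u) zero (suc b) b<1+a)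
  where
  b<1+a : suc b ≤ suc a
  b<1+a = ≤∧≢⇒< (s≤s⁻¹ b≤) b≢a

open LinkedPair using (x; y; x-inc; y-inc; link)

-- Increasing parking functions as linked pairs

extendℕ-of-toℕ : ∀ {m} (F : ℕ → ℕ) k → k < m → extendℕ {m} (F ∘ toℕ) k ≡ F k
extendℕ-of-toℕ {suc m} F zero    _   = refl
extendℕ-of-toℕ {suc m} F (suc k) k<m = extendℕ-of-toℕ (F ∘ suc) k (s≤s⁻¹ k<m)

concatAt : ℕ → (ℕ → ℕ) → (ℕ → ℕ) → ℕ → ℕ
concatAt a x y k with k <? a
... | yes _ = x k
... | no  _ = y (k ∸ a)

concatAt-< : ∀ a x y k → k < a → concatAt a x y k ≡ x k
concatAt-< a x y k k<a with k <? a
... | yes _   = refl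
... | no  k≮a = ⊥-elim (k≮a k<a)

concatAt-≥ : ∀ a x y k → a ≤ k → concatAt a x y k ≡ y (k ∸ a)
concatAt-≥ a x y k a≤k with k <? a
... | yes k<a = ⊥-elim (<-irrefl refl (<-≤-trans k<a a≤k))
... | no  _   = refl

concatAt-+ : ∀ a x y j → concatAt a x y (a + j) ≡ y j
concatAt-+ a x y j = trans (concatAt-≥ a x y (a + j) (m≤m+n a j)) (cong y (m+n∸m≡n a j))

module LinkedOnK (a q : ℕ) where
  open OnK a q

  conditions⇒linked : ∀ F → Positive N F → IncreasingOn a N F → BoxCondition a a q F →
                      LinkedPair a q q (suc a)
  conditions⇒linked F positive (inc-P , inc-Q) condition = linked F (λ j → F (a + j)) prefix-inc suffix-inc link′
    where
    x≤q : ∀ i → i < a → F i ≤ q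
    x≤q i i<a with condition i q (<⇒≤ i<a) ≤-refl (inj₁ i<a)
    ... | inj₁ (_ , F[i]≤q) = F[i]≤q
    ... | inj₂ (q<q , _)    = ⊥-elim (<-irrefl refl q<q)
    prefix-inc : IncSeq a q F
    prefix-inc = record { positive = λ i i<a → positive i (≤-trans i<a (m≤m+n a q)) ; bounded = x≤q ; monotone = inc-P }
    y≤1+a : ∀ j → j < q → F (a + j) ≤ suc a
    y≤1+a j j<q with condition a j ≤-refl (<⇒≤ j<q) (inj₂ j<q)
    ... | inj₁ (a<a , _)       = ⊥-elim (<-irrefl refl a<a)
    ... | inj₂ (_ , F[a+j]≤1+a) = F[a+j]≤1+a
    suffix-inc : IncSeq q (suc a) (λ j → F (a + j))
    suffix-inc = record
      { positive = λ j j<q → positive (a + j) (+-monoʳ-< a j<q)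
      ; bounded  = y≤1+a
      ; monotone = λ i j i≤j j<q → inc-Q (a + i) (a + j) (m≤m+n a i) (+-monoʳ-≤ a i≤j) (+-monoʳ-< a j<q)
      }
    link′ : ∀ k → k < a → F (a + (F k ∸ 1)) ≤ suc k
    link′ k k<a with condition k (F k ∸ 1) (<⇒≤ k<a) (≤-trans (m∸n≤m (F k) 1) (x≤q k k<a)) (inj₁ k<a)
    ... | inj₁ (_ , F[k]≤F[k]-1) = ⊥-elim (<-irrefl refl (<-≤-trans (pred<-of-bounded (positive k (≤-trans k<a (m≤m+n a q))) ≤-refl) F[k]≤F[k]-1))
    ... | inj₂ (_ , linked≤)     = linked≤

  suffix-index : ∀ {k} → a ≤ k → k < N → k ∸ a < q
  suffix-index a≤k k<N = +-cancelˡ-< a _ _ (subst (_< N) (sym (m+[n∸m]≡n a≤k)) k<N)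

  module _ (p : LinkedPair a q q (suc a)) where
    open IncSeq
    private
      xy : ℕ → ℕ
      xy = concatAt a (x p) (y p)

    concat-positive : Positive N xy
    concat-positive k k<N = by-side (k <? a)
      where
      by-side : Dec (k < a) → 1 ≤ xy k
      by-side (yes k<a) = subst (1 ≤_) (sym (concatAt-< a _ _ k k<a)) (positive (x-inc p) k k<a)
      by-side (no  k≮a) = subst (1 ≤_) (sym (concatAt-≥ a _ _ k (≮⇒≥ k≮a)))
                                (positive (y-inc p) (k ∸ a) (suffix-index (≮⇒≥ k≮a) k<N))

    concat-increasing : IncreasingOn a N xy
    concat-increasing = P-part , Q-part
      where
      P-part : ∀ i j → i ≤ j → j < a → xy i ≤ xy j
      P-part i j i≤j j<a rewrite concatAt-< a (x p) (y p) i (≤-<-trans i≤j j<a) | concatAt-< a (x p) (y p) j j<a =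
        monotone (x-inc p) i j i≤j j<a
      Q-part : ∀ i j → a ≤ i → i ≤ j → j < N → xy i ≤ xy j
      Q-part i j a≤i i≤j j<N rewrite concatAt-≥ a (x p) (y p) i a≤i | concatAt-≥ a (x p) (y p) j (≤-trans a≤i i≤j) =
        monotone (y-inc p) (i ∸ a) (j ∸ a) (∸-monoˡ-≤ a i≤j) (suffix-index (≤-trans a≤i i≤j) j<N)

    concat-boxCondition : BoxCondition a a q xy
    concat-boxCondition i j i≤a j≤q some = by-side (i <? a)
      where
      result : Set
      result = (i < a × xy i ≤ j) ⊎ (j < q × xy (a + j) ≤ suc i)
      by-value : i < a → Dec (x p i ≤ j) → result
      by-value i<a (yes x[i]≤j) = inj₁ (i<a , subst (_≤ j) (sym (concatAt-< a _ _ i i<a)) x[i]≤j)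
      by-value i<a (no  x[i]≰j) = inj₂ (<-≤-trans j<x[i] (bounded (x-inc p) i i<a) ,
        subst (_≤ suc i) (sym (concatAt-+ a _ _ j))
          (≤-trans (monotone (y-inc p) j (x p i ∸ 1) (subst (j ≤_) (pred[m∸n]≡m∸[1+n] (x p i) 0) (<⇒≤pred j<x[i]))
                    (pred<-of-bounded (positive (x-inc p) i i<a) (bounded (x-inc p) i i<a)))
                   (link p i i<a)))
        where
        j<x[i] : j < x p i
        j<x[i] = ≰⇒> x[i]≰j
      by-side : Dec (i < a) → result
      by-side (yes i<a) = by-value i<a (x p i ≤? j)
      by-side (no  i≮a) = inj₂ (j<q , subst (_≤ suc i) (sym (concatAt-+ a _ _ j))
                                   (subst (λ k → y p j ≤ suc k) (sym i≡a) (bounded (y-inc p) j j<q)))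
        where
        i≡a : i ≡ a
        i≡a = ≤-antisym i≤a (≮⇒≥ i≮a)
        j<q : j < q
        j<q = [ (λ i<a → ⊥-elim (i≮a i<a)) , id ]′ some

  increasingParking↔linked : Inverse (PFinc a q) (LinkedPairs a q q (suc a))
  increasingParking↔linked = mkInverseₛ to from (λ {f} {g} → to-cong {f} {g}) (λ {p} {p′} → from-cong {p} {p′}) to-from from-to
    where
    open Setoid (PFinc a q) using () renaming (Carrier to IncPF; _≈_ to _≈₁_)
    open Setoid (LinkedPairs a q q (suc a)) using () renaming (_≈_ to _≈₂_)
    to : IncPF → LinkedPair a q q (suc a)
    to (f , pf , inc) =
      conditions⇒linked (extendℕ f) (parking⇒positive rep pf) incN (parking⇒boxCondition rep pf incN)
      where
      rep : Represents f (extendℕ f)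
      rep = extendℕ-represents f
      incN : IncreasingOn a N (extendℕ f)
      incN = increasing⇒IncreasingOn rep inc
    from : LinkedPair a q q (suc a) → IncPF
    from p = concatAt a (x p) (y p) ∘ toℕ ,
             boxCondition⇒parking rep (concat-positive p) (concat-boxCondition p) ,
             IncreasingOn⇒increasing rep (concat-increasing p)
      where rep = represents (λ _ → refl)
    to-cong : ∀ {f g} → f ≈₁ g → to f ≈₂ to g
    to-cong f≗g = (λ i _ → extendℕ-cong f≗g i) , (λ j _ → extendℕ-cong f≗g (a + j))
    from-cong : ∀ {p p′} → p ≈₂ p′ → from p ≈₁ from p′
    from-cong {p} {p′} (x≗ , y≗) i = by-side (toℕ i <? a)
      where
      by-side : Dec (toℕ i < a) → concatAt a (x p) (y p) (toℕ i) ≡ concatAt a (x p′) (y p′) (toℕ i)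
      by-side (yes i<a) = trans (concatAt-< a _ _ _ i<a) (trans (x≗ _ i<a) (sym (concatAt-< a _ _ _ i<a)))
      by-side (no  i≮a) = trans (concatAt-≥ a _ _ _ a≤i)
                                (trans (y≗ _ (suffix-index a≤i (toℕ<n i))) (sym (concatAt-≥ a _ _ _ a≤i)))
        where a≤i = ≮⇒≥ i≮a
    to-from : ∀ p → to (from p) ≈₂ p
    to-from p =
      (λ i i<a → trans (extendℕ-of-toℕ xy i (≤-trans i<a (m≤m+n a q))) (concatAt-< a _ _ i i<a)) ,
      (λ j j<q → trans (extendℕ-of-toℕ xy (a + j) (+-monoʳ-< a j<q)) (concatAt-+ a _ _ j))
      where xy = concatAt a (x p) (y p)
    from-to : ∀ f → from (to f) ≈₁ f
    from-to (f , _) i = by-side (toℕ i <? a)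
      where
      by-side : Dec (toℕ i < a) → concatAt a (extendℕ f) (λ j → extendℕ f (a + j)) (toℕ i) ≡ f i
      by-side (yes i<a) = trans (concatAt-< a _ _ _ i<a) (extendℕ-toℕ f i)
      by-side (no  i≮a) = trans (concatAt-≥ a _ _ _ (≮⇒≥ i≮a))
                                (trans (cong (extendℕ f) (m+[n∸m]≡n (≮⇒≥ i≮a))) (extendℕ-toℕ f i))

theorem3p12 : (p q : ℕ) → 1 ≤ p → 1 ≤ q →
    Bijection (PPFinc p q) (PFinc (p ∸ 1) q) ×
    Σ ℕ (λ N → ((p + q ∸ 1) * N ≡ ((p + q ∸ 1) C p) * ((p + q ∸ 1) C (p ∸ 1)))
    × Bijection (PPFinc p q) (FinSetoid N)
    × Bijection (PFinc (p ∸ 1) q) (FinSetoid N))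
theorem3p12 (suc a) (suc q) _ _ =
  Inverse⇒Bijection primes↔parking ,
  linkedCount a (suc q) 0 (suc a) , linkedCount-closedForm a q ,
  Inverse⇒Bijection (Compose.inverse primes↔parking parking↔Fin) ,
  Inverse⇒Bijection parking↔Fin
  where
  primes↔parking : Inverse (PPFinc (suc a) (suc q)) (PFinc a (suc q))
  primes↔parking = PrimeOnK.prime↔parking a (suc q) (s≤s z≤n)
  parking↔Fin : Enumeration (PFinc a (suc q)) (linkedCount a (suc q) 0 (suc a))
  parking↔Fin = Compose.inverse (LinkedOnK.increasingParking↔linked a (suc q)) (enumerate a (suc q) 0 (suc a) ≤-refl)
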